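{- Let $s,k,n$ be integers and $m\ge 1$. Let $p,q,r,a,b,c$ be real numbers with $c\neq 0$, let $(P_n)_{n\in\mathbb{Z}}=\mathcal{P}(x)(p,q,r;a,b,c)$, $(U_n)_{n\in\mathbb{Z}}=\mathcal{P}(x)(0,0,1;a,b,c)$, and $\Delta_{\mathcal{P}}=(q^2-apq)x^2+(2qr-apr-bpq)x+(r^2-bpr-cp^2)$. Then \[ \det\big([P_{s+k(n+i+j)}^m]_{0\le i,j\le m}\big) = (-1)^{(s+kn+1)\binom{m+1}{2}}\,\Delta_{\mathcal{P}}^{\binom{m+1}{2}}\, c^{(s+kn)\binom{m+1}{2}+2k\binom{m+1}{3}}\prod_{i=0}^m\Big(\binom{m}{i}U_{k(i+1)}^{2(m-i)}\Big). \]
   Context: For real numbers $p,q,r,a,b,c$ with $c\neq 0$, $\mathcal{P}(x)(p,q,r;a,b,c)=(P_n)_{n\in\mathbb{Z}}$ denotes the sequence of polynomials in $x$ defined by $P_0=p$, $P_1=qx+r$, $P_{n+2}=(ax+b)P_{n+1}+cP_n$ for $n\ge 0$, and for $n<0$ by $P_n=-\frac{ax+b}{c}P_{n+1}+\frac{1}{c}P_{n+2}$; so $U_0=0$, $U_1=1$. $[M_{i,j}]_{0\le i,j\le m}$ is the $(m+1)\times(m+1)$ matrix with entry $M_{i,j}$ in row $i$, column $j$; $P^m_{t}$ means $(P_t)^m$. -}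

module Defs where

open import Level using (Level)
open import Algebra.Bundles using (CommutativeRing)
open import Data.Nat as ℕ using (ℕ; zero; suc)
open import Data.Integer as ℤ using (ℤ; +_; -[1+_])
open import Data.Fin using (Fin; zero; suc; punchIn)
open import Data.Product using (_×_; _,_; proj₁; proj₂)

-- Everything is developed over an arbitrary commutative ring R,
-- where the polynomial variable x is an (arbitrary) element of R.
module _ {ℓ₁ ℓ₂ : Level} (R : CommutativeRing ℓ₁ ℓ₂) where
  open CommutativeRing R using (Carrier; _+_; _*_; -_; _-_; 0#; 1#)

  pow : Carrier → ℕ → Carrier
  pow y zero    = 1#
  pow y (suc n) = y * pow y n

  natR : ℕ → Carrier
  natR zero    = 0#
  natR (suc n) = 1# + natR n

  signℤ : ℤ → Carrier
  signℤ e = pow (- 1#) (ℤ.∣ e ∣)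

  -- integer powers of c, given a two-sided inverse ci of c (c * ci ≈ 1)
  zpow : Carrier → Carrier → ℤ → Carrier
  zpow c ci (+ n)     = pow c n
  zpow c ci -[1+ n ]  = pow ci (suc n)

  sumF : (n : ℕ) → (Fin n → Carrier) → Carrier
  sumF zero    f = 0#
  sumF (suc n) f = f zero + sumF n (λ i → f (suc i))

  prodF : (n : ℕ) → (Fin n → Carrier) → Carrier
  prodF zero    f = 1#
  prodF (suc n) f = f zero * prodF n (λ i → f (suc i))

  det : (n : ℕ) → (Fin n → Fin n → Carrier) → Carrier
  det zero    M = 1#
  det (suc n) M =
    sumF (suc n) (λ j → pow (- 1#) (Data.Fin.toℕ j) * (M zero j *
      det n (λ i' j' → M (suc i') (punchIn j j'))))

  -- P_0 = p, P_1 = q x + r, P_{n+2} = (a x + b) P_{n+1} + c P_n,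
  -- and P_n = -(a x + b)/c P_{n+1} + 1/c P_{n+2} for n < 0,
  -- where 1/c is the given inverse ci.
  module Seq (p q r a b c ci x : Carrier) where
    -- (P_n , P_{n+1}) for n ≥ 0
    fwd : ℕ → Carrier × Carrier
    fwd zero    = p , q * x + r
    fwd (suc n) = proj₂ (fwd n) , (a * x + b) * proj₂ (fwd n) + c * proj₁ (fwd n)

    -- (P_{-n} , P_{-n+1}) for n ≥ 0
    bwd : ℕ → Carrier × Carrier
    bwd zero    = fwd zero
    bwd (suc n) = ci * (proj₂ (bwd n) - (a * x + b) * proj₁ (bwd n)) , proj₁ (bwd n)

    P : ℤ → Carrier
    P (+ n)     = proj₁ (fwd n)
    P -[1+ n ]  = proj₁ (bwd (suc n))

  seqP : (p q r a b c ci x : Carrier) → ℤ → Carrier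
  seqP p q r a b c ci x = Seq.P p q r a b c ci x

  ΔP : (p q r a b c x : Carrier) → Carrier
  ΔP p q r a b c x =
      (q * q - a * p * q) * (x * x)
    + (natR 2 * q * r - a * p * r - b * p * q) * x
    + (r * r - b * p * r - c * (p * p))

-- Adjoin to R a root t of X² - σ X - c, where σ = a x + b; the other root is t̄ = σ - t and t t̄ = -c is a
-- unit. Over R[t] every solution u of the recurrence satisfies u (a + b) = t̄ᵃ u b + U a (u 1 - t̄ u 0) tᵇ,
-- so for f i = P (s + k n + k i), A i = U (k i), μ = t̄ᵏ and λ = tᵏ the Hankel entries split as
-- f (i + j) = μⁱ f j + A i β λʲ, and likewise f j = α A j + P (s + k n) λʲ. Expanding the m-th power by the
-- binomial theorem twice factors [f (i + j) ^ m]ᵢⱼ as a product of the matrices [μ^(i l) (A i)^(m-l)]ᵢₗ,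
-- diag (m C l), a triangular matrix and [(A j)^l λ^(j (m-l))]ₗⱼ. The two "monomial" matrices are computed
-- by induction on m: passing from column j to j + 1 is a triangular linear map on (x , y), and its
-- symmetric powers are triangular. Finally α β = Δ (-c)^(s+kn) and μ λ = (-c)ᵏ.
-- Determinants are multiplicative because alternating multilinear forms are multiples of det.

module Submission where

open import Defs
open import Level using (Level; _⊔_)
open import Algebra.Bundles using (CommutativeRing; Semiring)
open import Algebra.Morphism.Structures using (IsRingHomomorphism; IsRingMonomorphism)
open import Data.Nat as ℕ using (ℕ; zero; suc; _≤_; _∸_)
import Data.Nat.Properties as ℕ
open import Data.Nat.Combinatorics using (_C_; nCn≡1; nC1≡n; k>n⇒nCk≡0; nCk+nC[k+1]≡[n+1]C[k+1])
open import Data.Integer as ℤ using (ℤ; +_; -[1+_])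
import Data.Integer.Properties as ℤ
open import Data.Integer.Solver using (module +-*-Solver)
open import Data.Sign as Sign using (Sign)
open import Data.Fin as Fin using (Fin; zero; suc; toℕ; punchIn; punchOut)
import Data.Fin.Properties as Fin
open import Data.Empty using (⊥-elim)
open import Data.Product as Product using (_,_; proj₁)
open import Function using (_∘_)
open import Data.Vec.Functional using (insertAt)
open import Data.Vec.Functional.Properties using (insertAt-punchIn)
open import Relation.Binary.Definitions using (tri<; tri≈; tri>)
open import Relation.Binary.Structures using (IsEquivalence)
open import Data.Maybe using (Maybe; just; nothing)
open import Relation.Nullary using (¬_; yes; no)
open import Relation.Binary.PropositionalEquality as ≡ using (_≡_; _≢_)
import Algebra.Solver.Ring.AlmostCommutativeRing as AlmostCommutativeRing
import Algebra.Solver.Ring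
import Algebra.Properties.Ring
import Algebra.Properties.CommutativeSemigroup
import Algebra.Properties.Semiring.Mult.TCOptimised

module IntegerCoefficients {ℓ₁ ℓ₂ : Level} (R : CommutativeRing ℓ₁ ℓ₂) where
  open CommutativeRing R
  open Algebra.Properties.Ring ring using (-‿distribˡ-*; -‿distribʳ-*; -‿involutive; -0#≈0#; -‿+-comm)
  open Algebra.Properties.Semiring.Mult.TCOptimised semiring using (_×_; 1+×; ×-homo-+; ×1-homo-*)
  open Algebra.Properties.CommutativeSemigroup +-commutativeSemigroup using (interchange)
  open import Relation.Binary.Reasoning.Setoid setoid

  fromℤ : ℤ → Carrier
  fromℤ (+ n)     = n × 1#
  fromℤ -[1+ n ] = - (suc n × 1#)

  fromℤ-⊖ : ∀ m n → fromℤ (m ℤ.⊖ n) ≈ m × 1# - n × 1#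
  fromℤ-⊖ zero    zero    = sym (trans (+-congˡ -0#≈0#) (+-identityʳ _))
  fromℤ-⊖ (suc m) zero    = sym (trans (+-congˡ -0#≈0#) (+-identityʳ _))
  fromℤ-⊖ zero    (suc n) = sym (+-identityˡ _)
  fromℤ-⊖ (suc m) (suc n) rewrite ℤ.[1+m]⊖[1+n]≡m⊖n m n = begin
    fromℤ (m ℤ.⊖ n)                         ≈⟨ fromℤ-⊖ m n ⟩
    m × 1# - n × 1#                         ≈⟨ +-identityˡ _ ⟨
    0# + (m × 1# - n × 1#)                  ≈⟨ +-congʳ (-‿inverseʳ 1#) ⟨
    (1# - 1#) + (m × 1# - n × 1#)           ≈⟨ interchange 1# (- 1#) (m × 1#) (- (n × 1#)) ⟩
    (1# + m × 1#) + (- 1# - n × 1#)         ≈⟨ +-congˡ (-‿+-comm 1# (n × 1#)) ⟩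
    (1# + m × 1#) - (1# + n × 1#)           ≈⟨ +-cong (1+× m 1#) (-‿cong (1+× n 1#)) ⟨
    suc m × 1# - suc n × 1#                 ∎

  fromℤ-◃-pos : ∀ n → fromℤ (Sign.+ ℤ.◃ n) ≈ n × 1#
  fromℤ-◃-pos zero    = refl
  fromℤ-◃-pos (suc n) = refl

  fromℤ-◃-neg : ∀ n → fromℤ (Sign.- ℤ.◃ n) ≈ - (n × 1#)
  fromℤ-◃-neg zero    = sym -0#≈0#
  fromℤ-◃-neg (suc n) = refl

  fromℤ-+ : ∀ i j → fromℤ (i ℤ.+ j) ≈ fromℤ i + fromℤ j
  fromℤ-+ (+ m)     (+ n)     = ×-homo-+ 1# m n
  fromℤ-+ (+ m)     -[1+ n ]  = fromℤ-⊖ m (suc n)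
  fromℤ-+ -[1+ m ]  (+ n)     = trans (fromℤ-⊖ n (suc m)) (+-comm _ _)
  fromℤ-+ -[1+ m ]  -[1+ n ]  = begin
    - (suc (suc (m ℕ.+ n)) × 1#)         ≡⟨ ≡.cong (λ k → - (suc k × 1#)) (ℕ.+-suc m n) ⟨
    - ((suc m ℕ.+ suc n) × 1#)           ≈⟨ -‿cong (×-homo-+ 1# (suc m) (suc n)) ⟩
    - (suc m × 1# + suc n × 1#)          ≈⟨ -‿+-comm _ _ ⟨
    - (suc m × 1#) + - (suc n × 1#)      ∎

  fromℤ-* : ∀ i j → fromℤ (i ℤ.* j) ≈ fromℤ i * fromℤ j
  fromℤ-* (+ m)     (+ n)     = trans (fromℤ-◃-pos (m ℕ.* n)) (×1-homo-* m n)
  fromℤ-* (+ m)     -[1+ n ]  = trans (fromℤ-◃-neg (m ℕ.* suc n)) (trans (-‿cong (×1-homo-* m (suc n))) (-‿distribʳ-* _ _))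
  fromℤ-* -[1+ m ]  (+ n)     = trans (fromℤ-◃-neg (suc m ℕ.* n)) (trans (-‿cong (×1-homo-* (suc m) n)) (-‿distribˡ-* _ _))
  fromℤ-* -[1+ m ]  -[1+ n ]  = begin
    fromℤ (Sign.+ ℤ.◃ (suc m ℕ.* suc n))  ≈⟨ fromℤ-◃-pos (suc m ℕ.* suc n) ⟩
    (suc m ℕ.* suc n) × 1#                ≈⟨ ×1-homo-* (suc m) (suc n) ⟩
    suc m × 1# * suc n × 1#               ≈⟨ -‿involutive _ ⟨
    - - (suc m × 1# * suc n × 1#)         ≈⟨ -‿cong (-‿distribˡ-* _ _) ⟩
    - (- (suc m × 1#) * suc n × 1#)       ≈⟨ -‿distribʳ-* _ _ ⟩
    - (suc m × 1#) * - (suc n × 1#)       ∎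

  fromℤ-neg : ∀ i → fromℤ (ℤ.- i) ≈ - fromℤ i
  fromℤ-neg (+ zero)  = sym -0#≈0#
  fromℤ-neg (+ suc n) = refl
  fromℤ-neg -[1+ n ]  = sym (-‿involutive _)

  homomorphism : ℤ.+-*-rawRing AlmostCommutativeRing.-Raw-AlmostCommutative⟶ AlmostCommutativeRing.fromCommutativeRing R
  homomorphism = record
    { ⟦_⟧ = fromℤ ; +-homo = fromℤ-+ ; *-homo = fromℤ-* ; -‿homo = fromℤ-neg
    ; 0-homo = refl ; 1-homo = refl }

  fromℤ-≟ : ∀ i j → Maybe (fromℤ i ≈ fromℤ j)
  fromℤ-≟ i j with i ℤ.≟ j
  ... | yes ≡.refl = just refl
  ... | no _       = nothing

  open Algebra.Solver.Ring ℤ.+-*-rawRing (AlmostCommutativeRing.fromCommutativeRing R) homomorphism fromℤ-≟ public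
    using (solve; _:+_; _:*_; _:-_; :-_; _:=_; con)

toℕ-punchIn-< : ∀ {n} (i : Fin (suc n)) (j : Fin n) → toℕ j ℕ.< toℕ i → toℕ (punchIn i j) ≡ toℕ j
toℕ-punchIn-< (suc i) zero    _         = ≡.refl
toℕ-punchIn-< (suc i) (suc j) (ℕ.s≤s j<i) = ≡.cong suc (toℕ-punchIn-< i j j<i)

toℕ-punchIn-≥ : ∀ {n} (i : Fin (suc n)) (j : Fin n) → toℕ i ℕ.≤ toℕ j → toℕ (punchIn i j) ≡ suc (toℕ j)
toℕ-punchIn-≥ zero    j       _         = ≡.refl
toℕ-punchIn-≥ (suc i) (suc j) (ℕ.s≤s i≤j) = ≡.cong suc (toℕ-punchIn-≥ i j i≤j)

toℕ-punchOut-< : ∀ {n} {i j : Fin (suc n)} (i≢j : i ≢ j) → toℕ j ℕ.< toℕ i → toℕ (punchOut i≢j) ≡ toℕ j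
toℕ-punchOut-< {suc n} {suc i} {zero}  i≢j _           = ≡.refl
toℕ-punchOut-< {suc n} {suc i} {suc j} i≢j (ℕ.s≤s j<i) = ≡.cong suc (toℕ-punchOut-< (i≢j ∘ ≡.cong suc) j<i)

toℕ-punchOut-> : ∀ {n} {i j : Fin (suc n)} (i≢j : i ≢ j) → toℕ i ℕ.< toℕ j → suc (toℕ (punchOut i≢j)) ≡ toℕ j
toℕ-punchOut-> {n}     {zero}  {suc j} i≢j _           = ≡.refl
toℕ-punchOut-> {suc n} {suc i} {suc j} i≢j (ℕ.s≤s i<j) = ≡.cong suc (toℕ-punchOut-> (i≢j ∘ ≡.cong suc) i<j)

punchOut-adjacent : ∀ {n} {j c c′ : Fin (suc n)} (j≢c : j ≢ c) (j≢c′ : j ≢ c′) → toℕ c′ ≡ suc (toℕ c) →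
                    toℕ (punchOut j≢c′) ≡ suc (toℕ (punchOut j≢c))
punchOut-adjacent {j = j} {c} {c′} j≢c j≢c′ c′≡1+c with ℕ.<-cmp (toℕ c) (toℕ j)
... | tri< c<j _ _ = begin
  toℕ (punchOut j≢c′)       ≡⟨ toℕ-punchOut-< j≢c′ c′<j ⟩
  toℕ c′                    ≡⟨ c′≡1+c ⟩
  suc (toℕ c)               ≡⟨ ≡.cong suc (toℕ-punchOut-< j≢c c<j) ⟨
  suc (toℕ (punchOut j≢c))  ∎
  where
  open ≡.≡-Reasoning
  c′<j : toℕ c′ ℕ.< toℕ j
  c′<j = ℕ.≤∧≢⇒< (≡.subst (ℕ._≤ toℕ j) (≡.sym c′≡1+c) c<j) (λ c′≡j → j≢c′ (Fin.toℕ-injective (≡.sym c′≡j)))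
... | tri≈ _ c≡j _ = ⊥-elim (j≢c (Fin.toℕ-injective (≡.sym c≡j)))
... | tri> _ _ j<c = ℕ.suc-injective (begin
  suc (toℕ (punchOut j≢c′))  ≡⟨ toℕ-punchOut-> j≢c′ (ℕ.<-trans j<c (≡.subst (toℕ c ℕ.<_) (≡.sym c′≡1+c) (ℕ.n<1+n (toℕ c)))) ⟩
  toℕ c′                     ≡⟨ c′≡1+c ⟩
  suc (toℕ c)                ≡⟨ ≡.cong suc (toℕ-punchOut-> j≢c j<c) ⟨
  suc (suc (toℕ (punchOut j≢c))) ∎)
  where open ≡.≡-Reasoning

case-≟ : ∀ {n p} {P : Fin n → Set p} (c : Fin n) → P c → (∀ j → j ≢ c → P j) → ∀ j → P j
case-≟ c Pc P≢ j with j Fin.≟ c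
... | yes ≡.refl = Pc
... | no j≢c     = P≢ j j≢c

insertAt-punchOut : ∀ {a n} {A : Set a} {x : A} (v : Fin n → A) {i r : Fin (suc n)} (i≢r : i ≢ r) →
                    insertAt v i x r ≡ v (punchOut i≢r)
insertAt-punchOut {x = x} v {i} {r} i≢r = begin
  insertAt v i x r                          ≡⟨ ≡.cong (insertAt v i x) (Fin.punchIn-punchOut i≢r) ⟨
  insertAt v i x (punchIn i (punchOut i≢r)) ≡⟨ insertAt-punchIn v i x (punchOut i≢r) ⟩
  v (punchOut i≢r)                          ∎
  where open ≡.≡-Reasoning

ℤ-induction : ∀ {p} (P : ℤ → Set p) → P (+ 0) → (∀ n → P n → P (ℤ.suc n)) → (∀ n → P (ℤ.suc n) → P n) → ∀ n → P n
ℤ-induction P P0 up down (+ zero)       = P0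
ℤ-induction P P0 up down (+ suc n)      = up (+ n) (ℤ-induction P P0 up down (+ n))
ℤ-induction P P0 up down -[1+ zero ]    = down -[1+ zero ] P0
ℤ-induction P P0 up down -[1+ suc n ]   = down -[1+ suc n ] (ℤ-induction P P0 up down -[1+ n ])

module Determinant {ℓ₁ ℓ₂ : Level} (R : CommutativeRing ℓ₁ ℓ₂) where
  open CommutativeRing R hiding (zero)
  open IntegerCoefficients R using (solve; _:+_; _:*_; _:-_; :-_; _:=_; con)
  open import Algebra.Properties.CommutativeSemiring.Exp commutativeSemiring using (_^_)
  open import Algebra.Definitions.RawSemiring (Semiring.rawSemiring semiring) using (product; _×_)
  open import Algebra.Properties.Semiring.Sum semiring
    using (sum; ∑-distrib-+; *-distribˡ-sum; *-distribʳ-sum; sum-cong-≋)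
  open import Relation.Binary.Reasoning.Setoid setoid

  pow≡^ : ∀ x n → pow R x n ≡ x ^ n
  pow≡^ x zero    = ≡.refl
  pow≡^ x (suc n) = ≡.cong (_*_ x) (pow≡^ x n)

  sumF≡sum : ∀ n (f : Fin n → Carrier) → sumF R n f ≡ sum f
  sumF≡sum zero    f = ≡.refl
  sumF≡sum (suc n) f = ≡.cong (_+_ (f zero)) (sumF≡sum n (λ i → f (suc i)))

  prodF≡product : ∀ n (f : Fin n → Carrier) → prodF R n f ≡ product f
  prodF≡product zero    f = ≡.refl
  prodF≡product (suc n) f = ≡.cong (_*_ (f zero)) (prodF≡product n (λ i → f (suc i)))

  natR≡×1# : ∀ n → natR R n ≡ n × 1#
  natR≡×1# zero    = ≡.refl
  natR≡×1# (suc n) = ≡.cong (_+_ 1#) (natR≡×1# n)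

  Matrix : ℕ → Set ℓ₁
  Matrix n = Fin n → Fin n → Carrier

  minor : ∀ {n} → Fin (suc n) → Matrix (suc n) → Matrix n
  minor j M i′ j′ = M (suc i′) (punchIn j j′)

  cofactorTerm : ∀ {n} → Matrix (suc n) → Fin (suc n) → Carrier
  cofactorTerm {n} M j = (- 1#) ^ toℕ j * (M zero j * det R n (minor j M))

  det-expand : ∀ {n} (M : Matrix (suc n)) → det R (suc n) M ≈ sum (cofactorTerm M)
  det-expand {n} M = begin
    det R (suc n) M       ≡⟨ sumF≡sum (suc n) cofactorTermₚ ⟩
    sum cofactorTermₚ     ≈⟨ sum-cong-≋ {x = cofactorTermₚ} {y = cofactorTerm M} (λ j → *-congʳ (reflexive (pow≡^ (- 1#) (toℕ j)))) ⟩
    sum (cofactorTerm M)  ∎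
    where
    cofactorTermₚ : Fin (suc n) → Carrier
    cofactorTermₚ j = pow R (- 1#) (toℕ j) * (M zero j * det R n (minor j M))

  ∑-zero : ∀ {n} (f : Fin n → Carrier) → (∀ i → f i ≈ 0#) → sum f ≈ 0#
  ∑-zero {zero}  f f≈0 = refl
  ∑-zero {suc n} f f≈0 = trans (+-cong (f≈0 zero) (∑-zero (f ∘ suc) (f≈0 ∘ suc))) (+-identityˡ 0#)

  ∑-single : ∀ {n} (f : Fin n → Carrier) (k : Fin n) → (∀ i → i ≢ k → f i ≈ 0#) → sum f ≈ f k
  ∑-single f zero    f≈0 = trans (+-congˡ (∑-zero (f ∘ suc) (λ i → f≈0 (suc i) (λ ())))) (+-identityʳ _)
  ∑-single f (suc k) f≈0 = trans (+-cong (f≈0 zero (λ ())) (∑-single (f ∘ suc) k (λ i i≢k → f≈0 (suc i) (i≢k ∘ Fin.suc-injective))))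
                                 (+-identityˡ _)

  ∑-pair : ∀ {n} (f : Fin n → Carrier) (c c′ : Fin n) → toℕ c′ ≡ suc (toℕ c) →
           (∀ j → j ≢ c → j ≢ c′ → f j ≈ 0#) → f c + f c′ ≈ 0# → sum f ≈ 0#
  ∑-pair f zero (suc zero) _ f≈0 cancel = begin
    f zero + (f (suc zero) + sum (λ i → f (suc (suc i))))
      ≈⟨ +-congˡ (+-congˡ (∑-zero (λ i → f (suc (suc i))) (λ i → f≈0 (suc (suc i)) (λ ()) (λ ())))) ⟩
    f zero + (f (suc zero) + 0#)                   ≈⟨ +-congˡ (+-identityʳ _) ⟩
    f zero + f (suc zero)                          ≈⟨ cancel ⟩
    0#                                             ∎
  ∑-pair f zero (suc (suc _)) () _ _
  ∑-pair f (suc c) (suc c′) c′≡1+c f≈0 cancel =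
    trans (+-cong (f≈0 zero (λ ()) (λ ()))
                  (∑-pair (f ∘ suc) c c′ (ℕ.suc-injective c′≡1+c)
                          (λ j j≢c j≢c′ → f≈0 (suc j) (j≢c ∘ Fin.suc-injective) (j≢c′ ∘ Fin.suc-injective)) cancel))
          (+-identityˡ 0#)

  det-cong : ∀ n {M N : Matrix n} → (∀ i j → M i j ≈ N i j) → det R n M ≈ det R n N
  det-cong zero    M≈N = refl
  det-cong (suc n) {M} {N} M≈N = begin
    det R (suc n) M       ≈⟨ det-expand M ⟩
    sum (cofactorTerm M)
      ≈⟨ sum-cong-≋ {x = cofactorTerm M} {y = cofactorTerm N}
                    (λ j → *-congˡ {(- 1#) ^ toℕ j} (*-cong (M≈N zero j) (det-cong n (λ i′ j′ → M≈N (suc i′) (punchIn j j′))))) ⟩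
    sum (cofactorTerm N)  ≈⟨ det-expand N ⟨
    det R (suc n) N       ∎

  AgreeOutside : ∀ {n} → Fin n → Matrix n → Matrix n → Set ℓ₂
  AgreeOutside c M N = ∀ i j → j ≢ c → M i j ≈ N i j

  minor-agreeOutside : ∀ {n} {c j : Fin (suc n)} {M N : Matrix (suc n)} → AgreeOutside c M N →
                       (j≢c : j ≢ c) → AgreeOutside (punchOut j≢c) (minor j M) (minor j N)
  minor-agreeOutside {c = c} {j} M≈N j≢c i′ j′ j′≢c′ = M≈N (suc i′) (punchIn j j′) punchIn≢c
    where
    punchIn≢c : punchIn j j′ ≢ c
    punchIn≢c eq = j′≢c′ (Fin.punchIn-injective j j′ (punchOut j≢c) (≡.trans eq (≡.sym (Fin.punchIn-punchOut j≢c))))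

  minor-agreeOutside-self : ∀ {n} {c : Fin (suc n)} {M N : Matrix (suc n)} → AgreeOutside c M N →
                            ∀ i′ j′ → minor c M i′ j′ ≈ minor c N i′ j′
  minor-agreeOutside-self {c = c} M≈N i′ j′ = M≈N (suc i′) (punchIn c j′) (Fin.punchInᵢ≢i c j′)

  minor-punchOut : ∀ {n} {c j : Fin (suc n)} (M : Matrix (suc n)) (j≢c : j ≢ c) i′ →
                   minor j M i′ (punchOut j≢c) ≡ M (suc i′) c
  minor-punchOut M j≢c i′ = ≡.cong (M (suc i′)) (Fin.punchIn-punchOut j≢c)

  det-additive : ∀ n (c : Fin n) (M A B : Matrix n) → AgreeOutside c M A → AgreeOutside c M B →
                 (∀ i → M i c ≈ A i c + B i c) → det R n M ≈ det R n A + det R n B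
  det-additive (suc n) c M A B M≈A M≈B Mc≈Ac+Bc = begin
    det R (suc n) M                                   ≈⟨ det-expand M ⟩
    sum (cofactorTerm M)                              ≈⟨ sum-cong-≋ {x = cofactorTerm M} {y = λ j → cofactorTerm A j + cofactorTerm B j} term ⟩
    sum (λ j → cofactorTerm A j + cofactorTerm B j)   ≈⟨ ∑-distrib-+ (cofactorTerm A) (cofactorTerm B) ⟩
    sum (cofactorTerm A) + sum (cofactorTerm B)       ≈⟨ +-cong (det-expand A) (det-expand B) ⟨
    det R (suc n) A + det R (suc n) B                 ∎
    where
    term : ∀ j → cofactorTerm M j ≈ cofactorTerm A j + cofactorTerm B j
    term j with j Fin.≟ c
    ... | yes ≡.refl = begin
      s * (M zero j * det R n (minor j M))                       ≈⟨ *-congˡ (*-congʳ (Mc≈Ac+Bc zero)) ⟩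
      s * ((A zero j + B zero j) * det R n (minor j M))
        ≈⟨ solve 4 (λ s a b d → s :* ((a :+ b) :* d) := s :* (a :* d) :+ s :* (b :* d)) refl s _ _ _ ⟩
      s * (A zero j * det R n (minor j M)) + s * (B zero j * det R n (minor j M))
        ≈⟨ +-cong (*-congˡ (*-congˡ (det-cong n (minor-agreeOutside-self M≈A))))
                  (*-congˡ (*-congˡ (det-cong n (minor-agreeOutside-self M≈B)))) ⟩
      s * (A zero j * det R n (minor j A)) + s * (B zero j * det R n (minor j B)) ∎
      where
      s : Carrier
      s = (- 1#) ^ toℕ j
    ... | no j≢c = begin
      s * (M zero j * det R n (minor j M))
        ≈⟨ *-congˡ (*-congˡ (det-additive n (punchOut j≢c) (minor j M) (minor j A) (minor j B)
                      (minor-agreeOutside M≈A j≢c) (minor-agreeOutside M≈B j≢c) minorColumn)) ⟩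
      s * (M zero j * (det R n (minor j A) + det R n (minor j B)))
        ≈⟨ solve 4 (λ s m a b → s :* (m :* (a :+ b)) := s :* (m :* a) :+ s :* (m :* b)) refl s _ _ _ ⟩
      s * (M zero j * det R n (minor j A)) + s * (M zero j * det R n (minor j B))
        ≈⟨ +-cong (*-congˡ (*-congʳ (M≈A zero j j≢c))) (*-congˡ (*-congʳ (M≈B zero j j≢c))) ⟩
      s * (A zero j * det R n (minor j A)) + s * (B zero j * det R n (minor j B)) ∎
      where
      s : Carrier
      s = (- 1#) ^ toℕ j
      minorColumn : ∀ i′ → minor j M i′ (punchOut j≢c) ≈ minor j A i′ (punchOut j≢c) + minor j B i′ (punchOut j≢c)
      minorColumn i′ rewrite minor-punchOut M j≢c i′ | minor-punchOut A j≢c i′ | minor-punchOut B j≢c i′ = Mc≈Ac+Bc (suc i′)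

  det-homogeneous : ∀ n (c : Fin n) (α : Carrier) (M A : Matrix n) → AgreeOutside c M A →
                    (∀ i → M i c ≈ α * A i c) → det R n M ≈ α * det R n A
  det-homogeneous (suc n) c α M A M≈A Mc≈αAc = begin
    det R (suc n) M                       ≈⟨ det-expand M ⟩
    sum (cofactorTerm M)                  ≈⟨ sum-cong-≋ {x = cofactorTerm M} {y = λ j → α * cofactorTerm A j} term ⟩
    sum (λ j → α * cofactorTerm A j)      ≈⟨ *-distribˡ-sum α (cofactorTerm A) ⟨
    α * sum (cofactorTerm A)              ≈⟨ *-congˡ (det-expand A) ⟨
    α * det R (suc n) A                   ∎
    where
    term : ∀ j → cofactorTerm M j ≈ α * cofactorTerm A j
    term j with j Fin.≟ c
    ... | yes ≡.refl = begin
      s * (M zero j * det R n (minor j M))        ≈⟨ *-congˡ (*-cong (Mc≈αAc zero) (det-cong n (minor-agreeOutside-self M≈A))) ⟩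
      s * ((α * A zero j) * det R n (minor j A))  ≈⟨ solve 4 (λ s a b d → s :* ((a :* b) :* d) := a :* (s :* (b :* d))) refl s _ _ _ ⟩
      α * (s * (A zero j * det R n (minor j A)))  ∎
      where
      s : Carrier
      s = (- 1#) ^ toℕ j
    ... | no j≢c = begin
      s * (M zero j * det R n (minor j M))
        ≈⟨ *-congˡ (*-cong (M≈A zero j j≢c) (det-homogeneous n (punchOut j≢c) α (minor j M) (minor j A)
                                               (minor-agreeOutside M≈A j≢c) minorColumn)) ⟩
      s * (A zero j * (α * det R n (minor j A)))  ≈⟨ solve 4 (λ s a b d → s :* (b :* (a :* d)) := a :* (s :* (b :* d))) refl s _ _ _ ⟩
      α * (s * (A zero j * det R n (minor j A)))  ∎
      where
      s : Carrier
      s = (- 1#) ^ toℕ j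
      minorColumn : ∀ i′ → minor j M i′ (punchOut j≢c) ≈ α * minor j A i′ (punchOut j≢c)
      minorColumn i′ rewrite minor-punchOut M j≢c i′ | minor-punchOut A j≢c i′ = Mc≈αAc (suc i′)

  minor-adjacent : ∀ {n} (M : Matrix (suc n)) {c c′ : Fin (suc n)} → toℕ c′ ≡ suc (toℕ c) →
                   (∀ i → M i c ≈ M i c′) → ∀ i′ j′ → minor c M i′ j′ ≈ minor c′ M i′ j′
  minor-adjacent M {c} {c′} c′≡1+c Mc≈Mc′ i′ j′ with ℕ.<-cmp (toℕ j′) (toℕ c)
  ... | tri< j′<c _ _ = reflexive (≡.cong (M (suc i′)) (Fin.toℕ-injective
          (≡.trans (toℕ-punchIn-< c j′ j′<c) (≡.sym (toℕ-punchIn-< c′ j′ j′<c′)))))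
    where
    j′<c′ : toℕ j′ ℕ.< toℕ c′
    j′<c′ = ≡.subst (toℕ j′ ℕ.<_) (≡.sym c′≡1+c) (ℕ.m<n⇒m<1+n j′<c)
  ... | tri≈ _ j′≡c _ = begin
    M (suc i′) (punchIn c j′)   ≡⟨ ≡.cong (M (suc i′)) punchIn-c≡c′ ⟩
    M (suc i′) c′               ≈⟨ Mc≈Mc′ (suc i′) ⟨
    M (suc i′) c                ≡⟨ ≡.cong (M (suc i′)) punchIn-c′≡c ⟨
    M (suc i′) (punchIn c′ j′)  ∎
    where
    punchIn-c≡c′ : punchIn c j′ ≡ c′
    punchIn-c≡c′ = Fin.toℕ-injective (≡.trans (toℕ-punchIn-≥ c j′ (ℕ.≤-reflexive (≡.sym j′≡c)))
                                               (≡.trans (≡.cong suc j′≡c) (≡.sym c′≡1+c)))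
    punchIn-c′≡c : punchIn c′ j′ ≡ c
    punchIn-c′≡c = Fin.toℕ-injective (≡.trans (toℕ-punchIn-< c′ j′ (≡.subst (toℕ j′ ℕ.<_) (≡.sym c′≡1+c)
                                                                             (ℕ.≤-reflexive (≡.cong suc j′≡c)))) j′≡c)
  ... | tri> _ _ c<j′ = reflexive (≡.cong (M (suc i′)) (Fin.toℕ-injective
          (≡.trans (toℕ-punchIn-≥ c j′ (ℕ.<⇒≤ c<j′)) (≡.sym (toℕ-punchIn-≥ c′ j′ c′≤j′)))))
    where
    c′≤j′ : toℕ c′ ℕ.≤ toℕ j′
    c′≤j′ = ≡.subst (ℕ._≤ toℕ j′) (≡.sym c′≡1+c) c<j′

  det-adjacent : ∀ n (M : Matrix n) (c c′ : Fin n) → toℕ c′ ≡ suc (toℕ c) →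
                 (∀ i → M i c ≈ M i c′) → det R n M ≈ 0#
  det-adjacent (suc n) M c c′ c′≡1+c Mc≈Mc′ =
    trans (det-expand M) (∑-pair (cofactorTerm M) c c′ c′≡1+c vanish cancel)
    where
    vanish : ∀ j → j ≢ c → j ≢ c′ → cofactorTerm M j ≈ 0#
    vanish j j≢c j≢c′ = begin
      (- 1#) ^ toℕ j * (M zero j * det R n (minor j M))  ≈⟨ *-congˡ (*-congˡ (det-adjacent n (minor j M) _ _
                                                              (punchOut-adjacent j≢c j≢c′ c′≡1+c) minorColumns)) ⟩
      (- 1#) ^ toℕ j * (M zero j * 0#)                   ≈⟨ trans (*-congˡ (zeroʳ _)) (zeroʳ _) ⟩
      0#                                                  ∎
      where
      minorColumns : ∀ i′ → minor j M i′ (punchOut j≢c) ≈ minor j M i′ (punchOut j≢c′)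
      minorColumns i′ rewrite minor-punchOut M j≢c i′ | minor-punchOut M j≢c′ i′ = Mc≈Mc′ (suc i′)
    cancel : cofactorTerm M c + cofactorTerm M c′ ≈ 0#
    cancel = begin
      s * (M zero c * d) + (- 1#) ^ toℕ c′ * (M zero c′ * det R n (minor c′ M))
        ≈⟨ +-congˡ (*-cong (reflexive (≡.cong ((- 1#) ^_) c′≡1+c))
                           (*-cong (sym (Mc≈Mc′ zero)) (det-cong n (λ i′ j′ → sym (minor-adjacent M c′≡1+c Mc≈Mc′ i′ j′))))) ⟩
      s * (M zero c * d) + (- 1# * s) * (M zero c * d)
        ≈⟨ solve 3 (λ s x d → s :* (x :* d) :+ (:- con (+ 1) :* s) :* (x :* d) := con (+ 0)) refl s (M zero c) d ⟩
      0#  ∎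
      where
      s : Carrier
      s = (- 1#) ^ toℕ c
      d : Carrier
      d = det R n (minor c M)

  record IsAlternatingForm {n} (Φ : Matrix n → Carrier) : Set (ℓ₁ ⊔ ℓ₂) where
    field
      cong        : ∀ {M N} → (∀ i j → M i j ≈ N i j) → Φ M ≈ Φ N
      additive    : ∀ c M A B → AgreeOutside c M A → AgreeOutside c M B →
                    (∀ i → M i c ≈ A i c + B i c) → Φ M ≈ Φ A + Φ B
      homogeneous : ∀ c α M A → AgreeOutside c M A → (∀ i → M i c ≈ α * A i c) → Φ M ≈ α * Φ A
      adjacent    : ∀ M c c′ → toℕ c′ ≡ suc (toℕ c) → (∀ i → M i c ≈ M i c′) → Φ M ≈ 0#

  det-isAlternatingForm : ∀ n → IsAlternatingForm (det R n)
  det-isAlternatingForm n = record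
    { cong = det-cong n ; additive = det-additive n ; homogeneous = det-homogeneous n ; adjacent = det-adjacent n }

  withColumn : ∀ {n} → Matrix n → Fin n → (Fin n → Carrier) → Matrix n
  withColumn M c u i j with j Fin.≟ c
  ... | yes _ = u i
  ... | no _  = M i j

  withColumn-at : ∀ {n} (M : Matrix n) c u i → withColumn M c u i c ≈ u i
  withColumn-at M c u i with c Fin.≟ c
  ... | yes _   = refl
  ... | no c≢c  = ⊥-elim (c≢c ≡.refl)

  withColumn-off : ∀ {n} (M : Matrix n) c u → AgreeOutside c (withColumn M c u) M
  withColumn-off M c u i j j≢c with j Fin.≟ c
  ... | yes j≡c = ⊥-elim (j≢c j≡c)
  ... | no _    = refl

  withColumns : ∀ {n} → Matrix n → Fin n → Fin n → (Fin n → Carrier) → (Fin n → Carrier) → Matrix n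
  withColumns M c₁ c₂ u v = withColumn (withColumn M c₁ u) c₂ v

  module _ {n} {c₁ c₂ : Fin n} (c₁≢c₂ : c₁ ≢ c₂) where

    withColumns-at₁ : ∀ M u v i → withColumns M c₁ c₂ u v i c₁ ≈ u i
    withColumns-at₁ M u v i = trans (withColumn-off _ c₂ v i c₁ c₁≢c₂) (withColumn-at M c₁ u i)

    withColumns-at₂ : ∀ M u v i → withColumns M c₁ c₂ u v i c₂ ≈ v i
    withColumns-at₂ M u v i = withColumn-at _ c₂ v i

    withColumns-off : ∀ M u v i j → j ≢ c₁ → j ≢ c₂ → withColumns M c₁ c₂ u v i j ≈ M i j
    withColumns-off M u v i j j≢c₁ j≢c₂ = trans (withColumn-off _ c₂ v i j j≢c₂) (withColumn-off M c₁ u i j j≢c₁)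

    withColumns-pointwise : ∀ {M N u v u′ v′} i j → (j ≡ c₁ → u i ≈ u′ i) → (j ≡ c₂ → v i ≈ v′ i) →
                            (j ≢ c₁ → j ≢ c₂ → M i j ≈ N i j) → withColumns M c₁ c₂ u v i j ≈ withColumns N c₁ c₂ u′ v′ i j
    withColumns-pointwise {M} {N} {u} {v} {u′} {v′} i = case-≟ c₁
      (λ u≈u′ _ _ → trans (withColumns-at₁ M u v i) (trans (u≈u′ ≡.refl) (sym (withColumns-at₁ N u′ v′ i))))
      (λ j j≢c₁ → case-≟ {P = λ j → j ≢ c₁ → (j ≡ c₁ → u i ≈ u′ i) → (j ≡ c₂ → v i ≈ v′ i) → (j ≢ c₁ → j ≢ c₂ → M i j ≈ N i j) →
                                   withColumns M c₁ c₂ u v i j ≈ withColumns N c₁ c₂ u′ v′ i j} c₂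
         (λ _ _ v≈v′ _ → trans (withColumns-at₂ M u v i) (trans (v≈v′ ≡.refl) (sym (withColumns-at₂ N u′ v′ i))))
         (λ j j≢c₂ j≢c₁ _ _ M≈N → trans (withColumns-off M u v i j j≢c₁ j≢c₂)
                                        (trans (M≈N j≢c₁ j≢c₂) (sym (withColumns-off N u′ v′ i j j≢c₁ j≢c₂)))) j j≢c₁)

    withColumns-self : ∀ M i j → withColumns M c₁ c₂ (λ i → M i c₁) (λ i → M i c₂) i j ≈ M i j
    withColumns-self M i = case-≟ c₁ (withColumns-at₁ M _ _ i)
      (λ j j≢c₁ → case-≟ {P = λ j → j ≢ c₁ → withColumns M c₁ c₂ (λ i → M i c₁) (λ i → M i c₂) i j ≈ M i j} c₂
                     (λ _ → withColumns-at₂ M _ _ i) (λ j j≢c₂ j≢c₁ → withColumns-off M _ _ i j j≢c₁ j≢c₂) j j≢c₁)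

  withColumn-agreeOutside : ∀ {n} (M : Matrix n) c u v → AgreeOutside c (withColumn M c u) (withColumn M c v)
  withColumn-agreeOutside M c u v i j j≢c = trans (withColumn-off M c u i j j≢c) (sym (withColumn-off M c v i j j≢c))

  swapColumns : ∀ {n} → Fin n → Fin n → Matrix n → Matrix n
  swapColumns a b M = withColumns M a b (λ i → M i b) (λ i → M i a)

  module IsAlternatingFormProperties {n} {Φ : Matrix n → Carrier} (alt : IsAlternatingForm Φ) where
    open IsAlternatingForm alt
    open Algebra.Properties.Ring ring using (+-inverseʳ-unique; -‿injective; -0#≈0#)

    zeroColumn : ∀ M c → (∀ i → M i c ≈ 0#) → Φ M ≈ 0#
    zeroColumn M c Mc≈0 = trans (homogeneous c 0# M M (λ _ _ _ → refl) (λ i → trans (Mc≈0 i) (sym (zeroˡ _)))) (zeroˡ _)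

    module _ {c₁ c₂ : Fin n} (c₁≢c₂ : c₁ ≢ c₂) (vanish : ∀ N → (∀ i → N i c₁ ≈ N i c₂) → Φ N ≈ 0#) where

      -- Expand Φ of the matrix with both columns c₁, c₂ equal to column c₁ + column c₂ of M.
      swap-negates : ∀ M M′ → (∀ i → M′ i c₁ ≈ M i c₂) → (∀ i → M′ i c₂ ≈ M i c₁) →
                     (∀ i j → j ≢ c₁ → j ≢ c₂ → M′ i j ≈ M i j) → Φ M′ ≈ - Φ M
      swap-negates M M′ M′c₁≈Mc₂ M′c₂≈Mc₁ M′≈M = +-inverseʳ-unique (Φ M) (Φ M′) (begin
        Φ M + Φ M′                                            ≈⟨ +-cong (+-identityˡ _) (+-identityʳ _) ⟨
        (0# + Φ M) + (Φ M′ + 0#)                              ≈⟨ +-cong (+-congʳ (vanish-mk a)) (+-congˡ (vanish-mk b)) ⟨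
        (Φ (mk a a) + Φ M) + (Φ M′ + Φ (mk b b))              ≈⟨ +-cong (+-congˡ (cong (withColumns-self c₁≢c₂ M))) (+-congʳ (cong mk-b-a≈M′)) ⟨
        (Φ (mk a a) + Φ (mk a b)) + (Φ (mk b a) + Φ (mk b b)) ≈⟨ +-cong (split₂ a) (split₂ b) ⟨
        Φ (mk a a+b) + Φ (mk b a+b)                           ≈⟨ split₁ ⟨
        Φ (mk a+b a+b)                                        ≈⟨ vanish-mk a+b ⟩
        0#                                                    ∎)
        where
        a b a+b : Fin n → Carrier
        a i   = M i c₁
        b i   = M i c₂
        a+b i = a i + b i

        mk : (Fin n → Carrier) → (Fin n → Carrier) → Matrix n
        mk = withColumns M c₁ c₂

        vanish-mk : ∀ u → Φ (mk u u) ≈ 0#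
        vanish-mk u = vanish (mk u u) (λ i → trans (withColumns-at₁ c₁≢c₂ M u u i) (sym (withColumns-at₂ c₁≢c₂ M u u i)))

        mk-b-a≈M′ : ∀ i j → mk b a i j ≈ M′ i j
        mk-b-a≈M′ i j = trans (withColumns-pointwise c₁≢c₂ i j (λ _ → sym (M′c₁≈Mc₂ i)) (λ _ → sym (M′c₂≈Mc₁ i)) (λ p q → sym (M′≈M i j p q)))
                              (withColumns-self c₁≢c₂ M′ i j)

        split₁ : Φ (mk a+b a+b) ≈ Φ (mk a a+b) + Φ (mk b a+b)
        split₁ = additive c₁ (mk a+b a+b) (mk a a+b) (mk b a+b) agree agree
                   (λ i → trans (withColumns-at₁ c₁≢c₂ M a+b a+b i) (sym (+-cong (withColumns-at₁ c₁≢c₂ M a a+b i) (withColumns-at₁ c₁≢c₂ M b a+b i))))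
          where
          agree : ∀ {u} → AgreeOutside c₁ (mk a+b a+b) (mk u a+b)
          agree i j j≢c₁ = withColumns-pointwise c₁≢c₂ i j (λ j≡c₁ → ⊥-elim (j≢c₁ j≡c₁)) (λ _ → refl) (λ _ _ → refl)

        split₂ : ∀ u → Φ (mk u a+b) ≈ Φ (mk u a) + Φ (mk u b)
        split₂ u = additive c₂ (mk u a+b) (mk u a) (mk u b) agree agree
                     (λ i → trans (withColumns-at₂ c₁≢c₂ M u a+b i) (sym (+-cong (withColumns-at₂ c₁≢c₂ M u a i) (withColumns-at₂ c₁≢c₂ M u b i))))
          where
          agree : ∀ {v} → AgreeOutside c₂ (mk u a+b) (mk u v)
          agree i j j≢c₂ = withColumns-pointwise c₁≢c₂ i j (λ _ → refl) (λ j≡c₂ → ⊥-elim (j≢c₂ j≡c₂)) (λ _ _ → refl)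

    equalColumns-distance : ∀ d M (c₁ c₂ : Fin n) → toℕ c₂ ≡ toℕ c₁ ℕ.+ suc d → (∀ i → M i c₁ ≈ M i c₂) → Φ M ≈ 0#
    equalColumns-distance zero    M c₁ c₂ c₂≡c₁+1 Mc₁≈Mc₂ = adjacent M c₁ c₂ (≡.trans c₂≡c₁+1 (ℕ.+-comm (toℕ c₁) 1)) Mc₁≈Mc₂
    equalColumns-distance (suc d) M c₁ c₂ c₂≡c₁+d+2 Mc₁≈Mc₂ =
      -‿injective (trans (sym swapped≈-ΦM) (trans swapped≈0 (sym -0#≈0#)))
      where
      c₃<n : toℕ c₁ ℕ.+ suc d ℕ.< n
      c₃<n = ℕ.<-trans (≡.subst (toℕ c₁ ℕ.+ suc d ℕ.<_) (≡.sym (≡.trans c₂≡c₁+d+2 (ℕ.+-suc (toℕ c₁) (suc d))))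
                                 (ℕ.n<1+n _)) (Fin.toℕ<n c₂)
      c₃ : Fin n
      c₃ = Fin.fromℕ< c₃<n
      toℕ-c₃ : toℕ c₃ ≡ toℕ c₁ ℕ.+ suc d
      toℕ-c₃ = Fin.toℕ-fromℕ< c₃<n
      c₂≡c₃+1 : toℕ c₂ ≡ suc (toℕ c₃)
      c₂≡c₃+1 = ≡.trans c₂≡c₁+d+2 (≡.trans (ℕ.+-suc (toℕ c₁) (suc d)) (≡.cong suc (≡.sym toℕ-c₃)))
      c₃≢c₂ : c₃ ≢ c₂
      c₃≢c₂ c₃≡c₂ = ℕ.1+n≢n (≡.sym (≡.trans (≡.cong toℕ c₃≡c₂) c₂≡c₃+1))
      c₁≢c₃ : c₁ ≢ c₃
      c₁≢c₃ c₁≡c₃ = ℕ.m≢1+m+n (toℕ c₁) (≡.trans (≡.cong toℕ c₁≡c₃) (≡.trans toℕ-c₃ (ℕ.+-suc (toℕ c₁) d)))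
      c₁≢c₂ : c₁ ≢ c₂
      c₁≢c₂ c₁≡c₂ = ℕ.m≢1+m+n (toℕ c₁) (≡.trans (≡.cong toℕ c₁≡c₂) (≡.trans c₂≡c₁+d+2 (ℕ.+-suc (toℕ c₁) (suc d))))
      swapped≈-ΦM : Φ (swapColumns c₃ c₂ M) ≈ - Φ M
      swapped≈-ΦM = swap-negates c₃≢c₂ (λ N → adjacent N c₃ c₂ c₂≡c₃+1) M (swapColumns c₃ c₂ M)
                      (withColumns-at₁ c₃≢c₂ M _ _) (withColumns-at₂ c₃≢c₂ M _ _) (withColumns-off c₃≢c₂ M _ _)
      swapped≈0 : Φ (swapColumns c₃ c₂ M) ≈ 0#
      swapped≈0 = equalColumns-distance d (swapColumns c₃ c₂ M) c₁ c₃ toℕ-c₃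
                    (λ i → trans (withColumns-off c₃≢c₂ M _ _ i c₁ c₁≢c₃ c₁≢c₂) (trans (Mc₁≈Mc₂ i) (sym (withColumns-at₁ c₃≢c₂ M _ _ i))))

    equalColumns : ∀ M (c₁ c₂ : Fin n) → c₁ ≢ c₂ → (∀ i → M i c₁ ≈ M i c₂) → Φ M ≈ 0#
    equalColumns M c₁ c₂ c₁≢c₂ Mc₁≈Mc₂ with ℕ.<-cmp (toℕ c₁) (toℕ c₂)
    ... | tri< c₁<c₂ _ _ = let (d , c₁+1+d≡c₂) = ℕ.m≤n⇒∃[o]m+o≡n c₁<c₂ in
      equalColumns-distance d M c₁ c₂ (≡.trans (≡.sym c₁+1+d≡c₂) (≡.sym (ℕ.+-suc (toℕ c₁) d))) Mc₁≈Mc₂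
    ... | tri≈ _ c₁≡c₂ _ = ⊥-elim (c₁≢c₂ (Fin.toℕ-injective c₁≡c₂))
    ... | tri> _ _ c₂<c₁ = let (d , c₂+1+d≡c₁) = ℕ.m≤n⇒∃[o]m+o≡n c₂<c₁ in
      equalColumns-distance d M c₂ c₁ (≡.trans (≡.sym c₂+1+d≡c₁) (≡.sym (ℕ.+-suc (toℕ c₂) d))) (λ i → sym (Mc₁≈Mc₂ i))

    swap : ∀ {c₁ c₂ : Fin n} → c₁ ≢ c₂ → ∀ M M′ → (∀ i → M′ i c₁ ≈ M i c₂) → (∀ i → M′ i c₂ ≈ M i c₁) →
           (∀ i j → j ≢ c₁ → j ≢ c₂ → M′ i j ≈ M i j) → Φ M′ ≈ - Φ M
    swap {c₁} {c₂} c₁≢c₂ = swap-negates c₁≢c₂ (λ N → equalColumns N c₁ c₂ c₁≢c₂)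

    linearInColumn : ∀ (c : Fin n) M {m} (f : Fin m → Carrier) (vs : Fin m → Fin n → Carrier) →
                     (∀ i → M i c ≈ sum (λ k → f k * vs k i)) → Φ M ≈ sum (λ k → f k * Φ (withColumn M c (vs k)))
    linearInColumn c M {zero}  f vs Mc≈ = zeroColumn M c Mc≈
    linearInColumn c M {suc m} f vs Mc≈ = begin
      Φ M                  ≈⟨ additive c M M₀ M₊ (λ i j j≢c → sym (withColumn-off M c _ i j j≢c))
                                              (λ i j j≢c → sym (withColumn-off M c _ i j j≢c))
                                              (λ i → trans (Mc≈ i) (sym (+-cong (withColumn-at M c _ i) (withColumn-at M c _ i)))) ⟩
      Φ M₀ + Φ M₊          ≈⟨ +-cong (homogeneous c (f zero) M₀ (withColumn M c (vs zero))
                                       (withColumn-agreeOutside M c _ _)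
                                       (λ i → trans (withColumn-at M c _ i) (*-congˡ (sym (withColumn-at M c _ i)))))
                                     (trans (linearInColumn c M₊ (f ∘ suc) (vs ∘ suc) (withColumn-at M c _))
                                            (sum-cong-≋ {x = λ k → f (suc k) * Φ (withColumn M₊ c (vs (suc k)))}
                                                        {y = λ k → f (suc k) * Φ (withColumn M c (vs (suc k)))}
                                                        (λ k → *-congˡ (cong (withColumn-twice k))))) ⟩
      f zero * Φ (withColumn M c (vs zero)) + sum (λ k → f (suc k) * Φ (withColumn M c (vs (suc k)))) ∎
      where
      M₀ M₊ : Matrix n
      M₀ = withColumn M c (λ i → f zero * vs zero i)
      M₊ = withColumn M c (λ i → sum (λ k → f (suc k) * vs (suc k) i))
      withColumn-twice : ∀ k i j → withColumn M₊ c (vs (suc k)) i j ≈ withColumn M c (vs (suc k)) i j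
      withColumn-twice k i = case-≟ c (trans (withColumn-at M₊ c _ i) (sym (withColumn-at M c _ i)))
        (λ j j≢c → trans (withColumn-off M₊ c _ i j j≢c) (trans (withColumn-off M c _ i j j≢c) (sym (withColumn-off M c _ i j j≢c))))

  δ : ∀ {n} → Matrix n
  δ zero    zero    = 1#
  δ zero    (suc _) = 0#
  δ (suc _) zero    = 0#
  δ (suc i) (suc j) = δ i j

  δ-diag : ∀ {n} (i : Fin n) → δ i i ≡ 1#
  δ-diag zero    = ≡.refl
  δ-diag (suc i) = δ-diag i

  δ-off : ∀ {n} (i j : Fin n) → i ≢ j → δ i j ≡ 0#
  δ-off zero    zero    i≢j = ⊥-elim (i≢j ≡.refl)
  δ-off zero    (suc j) _   = ≡.refl
  δ-off (suc i) zero    _   = ≡.refl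
  δ-off (suc i) (suc j) i≢j = δ-off i j (i≢j ∘ ≡.cong suc)

  ∑-δ : ∀ {n} (f : Fin n → Carrier) (j : Fin n) → sum (λ i → f i * δ i j) ≈ f j
  ∑-δ f j = trans (∑-single (λ i → f i * δ i j) j (λ i i≢j → trans (*-congˡ (reflexive (δ-off i j i≢j))) (zeroʳ _)))
                  (trans (*-congˡ (reflexive (δ-diag j))) (*-identityʳ _))

  det-δ : ∀ n → det R n δ ≈ 1#
  det-δ zero    = refl
  det-δ (suc n) = begin
    det R (suc n) δ               ≈⟨ det-expand (δ {suc n}) ⟩
    sum (cofactorTerm (δ {suc n})) ≈⟨ +-cong (trans (*-identityˡ _) (trans (*-identityˡ _) (det-δ n)))
                                            (∑-zero (λ j → cofactorTerm (δ {suc n}) (suc j)) (λ j → trans (*-congˡ (zeroˡ _)) (zeroʳ _))) ⟩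
    1# + 0#                       ≈⟨ +-identityʳ 1# ⟩
    1#                            ∎

  insertAt-cong : ∀ {n} (i : Fin (suc n)) {u v : Fin n → Carrier} → (∀ r → u r ≈ v r) →
                  ∀ r → insertAt u i 0# r ≈ insertAt v i 0# r
  insertAt-cong zero          u≈v zero    = refl
  insertAt-cong zero          u≈v (suc r) = u≈v r
  insertAt-cong {suc n} (suc i) u≈v zero    = u≈v zero
  insertAt-cong {suc n} (suc i) u≈v (suc r) = insertAt-cong i (u≈v ∘ suc) r

  insertAt-+ : ∀ {n} (i : Fin (suc n)) {u v w : Fin n → Carrier} → (∀ r → u r ≈ v r + w r) →
               ∀ r → insertAt u i 0# r ≈ insertAt v i 0# r + insertAt w i 0# r
  insertAt-+ zero          u≈v+w zero    = sym (+-identityˡ 0#)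
  insertAt-+ zero          u≈v+w (suc r) = u≈v+w r
  insertAt-+ {suc n} (suc i) u≈v+w zero    = u≈v+w zero
  insertAt-+ {suc n} (suc i) u≈v+w (suc r) = insertAt-+ i (u≈v+w ∘ suc) r

  insertAt-* : ∀ {n} (i : Fin (suc n)) α {u v : Fin n → Carrier} → (∀ r → u r ≈ α * v r) →
               ∀ r → insertAt u i 0# r ≈ α * insertAt v i 0# r
  insertAt-* zero          α u≈αv zero    = sym (zeroʳ α)
  insertAt-* zero          α u≈αv (suc r) = u≈αv r
  insertAt-* {suc n} (suc i) α u≈αv zero    = u≈αv zero
  insertAt-* {suc n} (suc i) α u≈αv (suc r) = insertAt-* i α (u≈αv ∘ suc) r

  insertAt-0# : ∀ {n} (i : Fin (suc n)) r → insertAt (λ _ → 0#) i 0# r ≈ 0#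
  insertAt-0# zero          zero    = refl
  insertAt-0# zero          (suc r) = refl
  insertAt-0# {suc n} (suc i) zero    = refl
  insertAt-0# {suc n} (suc i) (suc r) = insertAt-0# i r

  extendAt : ∀ {n} → Fin (suc n) → Matrix n → Matrix (suc n)
  extendAt i Z r zero    = δ i r
  extendAt i Z r (suc j) = insertAt (λ r′ → Z r′ j) i 0# r

  extendAt-isAlternatingForm : ∀ {n} (i : Fin (suc n)) {Φ : Matrix (suc n) → Carrier} →
                               IsAlternatingForm Φ → IsAlternatingForm (λ Z → Φ (extendAt i Z))
  extendAt-isAlternatingForm {n} i {Φ} alt = record
    { cong        = λ {M} {N} M≈N → cong (extendAt-cong M≈N)
    ; additive    = λ c M A B M≈A M≈B Mc≈ → additive (suc c) _ _ _ (extendAt-agree M≈A) (extendAt-agree M≈B) (insertAt-+ i Mc≈)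
    ; homogeneous = λ c α M A M≈A Mc≈ → homogeneous (suc c) α _ _ (extendAt-agree M≈A) (insertAt-* i α Mc≈)
    ; adjacent    = λ M c c′ c′≡1+c Mc≈Mc′ → adjacent _ (suc c) (suc c′) (≡.cong suc c′≡1+c) (insertAt-cong i Mc≈Mc′)
    }
    where
    open IsAlternatingForm alt
    extendAt-cong : ∀ {M N : Matrix n} → (∀ r j → M r j ≈ N r j) → ∀ r j → extendAt i M r j ≈ extendAt i N r j
    extendAt-cong M≈N r zero    = refl
    extendAt-cong M≈N r (suc j) = insertAt-cong i (λ r′ → M≈N r′ j) r
    extendAt-agree : ∀ {M N : Matrix n} {c} → AgreeOutside c M N → AgreeOutside (suc c) (extendAt i M) (extendAt i N)
    extendAt-agree M≈N r zero    _       = refl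
    extendAt-agree M≈N r (suc j) 1+j≢1+c = insertAt-cong i (λ r′ → M≈N r′ j (1+j≢1+c ∘ ≡.cong suc)) r

  extendAt-δ : ∀ n (i : Fin (suc n)) {Φ : Matrix (suc n) → Carrier} → IsAlternatingForm Φ →
               Φ (extendAt i δ) ≈ (- 1#) ^ toℕ i * Φ δ
  extendAt-δ n zero {Φ} alt = trans (IsAlternatingForm.cong alt extendAt-zero-δ) (sym (*-identityˡ _))
    where
    extendAt-zero-δ : ∀ r j → extendAt zero δ r j ≈ δ r j
    extendAt-zero-δ zero    zero    = refl
    extendAt-zero-δ zero    (suc j) = refl
    extendAt-zero-δ (suc r) zero    = refl
    extendAt-zero-δ (suc r) (suc j) = refl
  extendAt-δ (suc n) (suc i) {Φ} alt = begin
    Φ M                                  ≈⟨ -‿involutive _ ⟨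
    - - Φ M                              ≈⟨ -‿cong swapped ⟨
    - Φ M′                               ≈⟨ -‿cong (extendAt-δ n i (extendAt-isAlternatingForm zero alt)) ⟩
    - ((- 1#) ^ toℕ i * Φ (extendAt zero δ)) ≈⟨ -‿cong (*-congˡ (extendAt-δ (suc n) zero alt)) ⟩
    - ((- 1#) ^ toℕ i * (1# * Φ δ))      ≈⟨ -‿cong (*-congˡ (*-identityˡ _)) ⟩
    - ((- 1#) ^ toℕ i * Φ δ)             ≈⟨ -1*x≈-x _ ⟨
    - 1# * ((- 1#) ^ toℕ i * Φ δ)        ≈⟨ *-assoc _ _ _ ⟨
    (- 1#) ^ toℕ (suc i) * Φ δ           ∎
    where
    open IsAlternatingForm alt
    open IsAlternatingFormProperties alt
    open Algebra.Properties.Ring ring using (-‿involutive; -1*x≈-x)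
    M M′ : Matrix (suc (suc n))
    M  = extendAt (suc i) δ
    M′ = extendAt zero (extendAt i δ)
    M′₀≈M₁ : ∀ r → M′ r zero ≈ M r (suc zero)
    M′₀≈M₁ zero    = refl
    M′₀≈M₁ (suc r) = sym (insertAt-0# i r)
    M′₁≈M₀ : ∀ r → M′ r (suc zero) ≈ M r zero
    M′₁≈M₀ zero    = refl
    M′₁≈M₀ (suc r) = refl
    M′≈M : ∀ r j → j ≢ zero → j ≢ suc zero → M′ r j ≈ M r j
    M′≈M r       zero          j≢0 _   = ⊥-elim (j≢0 ≡.refl)
    M′≈M r       (suc zero)    _   j≢1 = ⊥-elim (j≢1 ≡.refl)
    M′≈M zero    (suc (suc j)) _   _   = refl
    M′≈M (suc r) (suc (suc j)) _   _   = refl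
    swapped : Φ M′ ≈ - Φ M
    swapped = swap (λ ()) M M′ M′₀≈M₁ M′₁≈M₀ M′≈M

  module RowIndependence {n} {Φ : Matrix (suc n) → Carrier} (alt : IsAlternatingForm Φ) (i : Fin (suc n)) where
    open IsAlternatingForm alt
    open IsAlternatingFormProperties alt

    -- With the unit vector eᵢ as first column, changing row i of another column adds a multiple of eᵢ.
    changeRow : ∀ N c (u : Fin (suc n) → Carrier) → (∀ r → N r zero ≈ δ i r) → (∀ r → r ≢ i → u r ≈ N r (suc c)) →
                Φ (withColumn N (suc c) u) ≈ Φ N
    changeRow N c u N₀≈eᵢ u≈Nc = begin
      Φ (withColumn N (suc c) u)
        ≈⟨ additive (suc c) _ (withColumn N (suc c) (λ r → N r (suc c))) (withColumn N (suc c) (λ r → t * δ i r))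
                    (withColumn-agreeOutside N (suc c) u _) (withColumn-agreeOutside N (suc c) u _) (λ r → trans (withColumn-at N (suc c) u r)
                                          (trans (u≈Nc+teᵢ r) (sym (+-cong (withColumn-at N (suc c) _ r) (withColumn-at N (suc c) _ r))))) ⟩
      Φ (withColumn N (suc c) (λ r → N r (suc c))) + Φ (withColumn N (suc c) (λ r → t * δ i r))
        ≈⟨ +-cong (cong (λ r → case-≟ (suc c) (withColumn-at N (suc c) _ r) (withColumn-off N (suc c) _ r)))
                  (trans (homogeneous (suc c) t _ (withColumn N (suc c) (δ i)) (withColumn-agreeOutside N (suc c) _ _)
                                      (λ r → trans (withColumn-at N (suc c) _ r) (*-congˡ (sym (withColumn-at N (suc c) _ r)))))
                         (trans (*-congˡ (equalColumns _ zero (suc c) (λ ()) eᵢ-twice)) (zeroʳ t))) ⟩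
      Φ N + 0#   ≈⟨ +-identityʳ _ ⟩
      Φ N        ∎
      where
      t : Carrier
      t = u i - N i (suc c)
      eᵢ-twice : ∀ r → withColumn N (suc c) (δ i) r zero ≈ withColumn N (suc c) (δ i) r (suc c)
      eᵢ-twice r = trans (withColumn-off N (suc c) (δ i) r zero (λ ())) (trans (N₀≈eᵢ r) (sym (withColumn-at N (suc c) (δ i) r)))
      u≈Nc+teᵢ : ∀ r → u r ≈ N r (suc c) + t * δ i r
      u≈Nc+teᵢ = case-≟ i
        (trans (solve 2 (λ a b → a := b :+ (a :- b) :* con (+ 1)) refl (u i) (N i (suc c))) (+-congˡ (*-congˡ (sym (reflexive (δ-diag i))))))
        (λ r r≢i → trans (u≈Nc r r≢i) (sym (trans (+-congˡ (trans (*-congˡ (reflexive (δ-off i r (r≢i ∘ ≡.sym)))) (zeroʳ t))) (+-identityʳ _))))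

    rowIndependence : ∀ M M′ → (∀ r → M r zero ≈ δ i r) → (∀ r → M′ r zero ≈ δ i r) →
                      (∀ r j → r ≢ i → M r (suc j) ≈ M′ r (suc j)) → Φ M ≈ Φ M′
    rowIndependence M M′ M₀≈eᵢ M′₀≈eᵢ M≈M′ = begin
      Φ M                 ≈⟨ cong (λ r j → hybrid-≥ 0 r j (λ ())) ⟨
      Φ (hybrid 0)        ≈⟨ hybrid-chain (suc n) ⟨
      Φ (hybrid (suc n))  ≈⟨ cong (λ r j → hybrid-< (suc n) r j (Fin.toℕ<n j)) ⟩
      Φ M′                ∎
      where
      hybrid : ℕ → Matrix (suc n)
      hybrid k r j with toℕ j ℕ.<? k
      ... | yes _ = M′ r j
      ... | no _  = M r j

      hybrid-< : ∀ k r j → toℕ j ℕ.< k → hybrid k r j ≈ M′ r j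
      hybrid-< k r j j<k with toℕ j ℕ.<? k
      ... | yes _  = refl
      ... | no j≮k = ⊥-elim (j≮k j<k)

      hybrid-≥ : ∀ k r j → ¬ (toℕ j ℕ.< k) → hybrid k r j ≈ M r j
      hybrid-≥ k r j j≮k with toℕ j ℕ.<? k
      ... | yes j<k = ⊥-elim (j≮k j<k)
      ... | no _    = refl

      hybrid-zero : ∀ k r → hybrid k r zero ≈ δ i r
      hybrid-zero k r with toℕ {suc n} zero ℕ.<? k
      ... | yes _ = M′₀≈eᵢ r
      ... | no _  = M₀≈eᵢ r

      hybrid-same : ∀ k r j → toℕ j ≢ k → hybrid (suc k) r j ≈ hybrid k r j
      hybrid-same k r j j≢k with toℕ j ℕ.<? suc k | toℕ j ℕ.<? k
      ... | yes _    | yes _  = refl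
      ... | no _     | no _   = refl
      ... | yes j<1+k | no j≮k = ⊥-elim (j≢k (ℕ.≤-antisym (ℕ.≤-pred j<1+k) (ℕ.≮⇒≥ j≮k)))
      ... | no j≮1+k | yes j<k = ⊥-elim (j≮1+k (ℕ.m<n⇒m<1+n j<k))

      hybrid-step : ∀ k → Φ (hybrid (suc k)) ≈ Φ (hybrid k)
      hybrid-step zero = cong λ where
        r zero    → trans (hybrid-zero 1 r) (sym (hybrid-zero 0 r))
        r (suc j) → hybrid-same 0 r (suc j) (λ ())
      hybrid-step (suc k) with suc k ℕ.<? suc n
      ... | no 1+k≮1+n = cong (λ r j → hybrid-same (suc k) r j (λ j≡1+k → 1+k≮1+n (≡.subst (ℕ._< suc n) j≡1+k (Fin.toℕ<n j))))
      ... | yes 1+k<1+n = trans (cong hybrid≈withColumn)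
                                (changeRow (hybrid (suc k)) c (λ r → M′ r (suc c)) (hybrid-zero (suc k))
                                           (λ r r≢i → trans (sym (M≈M′ r c r≢i)) (sym (hybrid-≥ (suc k) r (suc c) (λ 1+c<1+k → ℕ.<-irrefl toℕ-c (ℕ.≤-pred 1+c<1+k))))))
        where
        c : Fin n
        c = Fin.fromℕ< (ℕ.≤-pred 1+k<1+n)
        toℕ-c : toℕ c ≡ k
        toℕ-c = Fin.toℕ-fromℕ< (ℕ.≤-pred 1+k<1+n)
        hybrid≈withColumn : ∀ r j → hybrid (suc (suc k)) r j ≈ withColumn (hybrid (suc k)) (suc c) (λ r → M′ r (suc c)) r j
        hybrid≈withColumn r = case-≟ (suc c)
          (trans (hybrid-< (suc (suc k)) r (suc c) (ℕ.s≤s (ℕ.s≤s (ℕ.≤-reflexive toℕ-c)))) (sym (withColumn-at _ (suc c) _ r)))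
          (λ j j≢1+c → trans (hybrid-same (suc k) r j (λ j≡1+k → j≢1+c (Fin.toℕ-injective (≡.trans j≡1+k (≡.cong suc (≡.sym toℕ-c))))))
                             (sym (withColumn-off _ (suc c) _ r j j≢1+c)))

      hybrid-chain : ∀ k → Φ (hybrid k) ≈ Φ (hybrid 0)
      hybrid-chain zero    = refl
      hybrid-chain (suc k) = trans (hybrid-step k) (hybrid-chain k)

  columnMinor : ∀ {n} → Fin (suc n) → Matrix (suc n) → Matrix n
  columnMinor i Y r′ j′ = Y (punchIn i r′) (suc j′)

  firstColumnExpansion : ∀ {n} → Matrix (suc n) → Carrier
  firstColumnExpansion {n} Y = sum (λ i → (- 1#) ^ toℕ i * (Y i zero * det R n (columnMinor i Y)))

  -- Expand the first column of Y in unit vectors; clearing row i of the other columns reduces the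
  -- i-th summand to the alternating form Z ↦ Φ (extendAt i Z) in dimension n.
  alternating≈firstColumnExpansion :
    ∀ n → (∀ (Ψ : Matrix n → Carrier) → IsAlternatingForm Ψ → ∀ Z → Ψ Z ≈ det R n Z * Ψ δ) →
    ∀ (Φ : Matrix (suc n) → Carrier) → IsAlternatingForm Φ → ∀ Y → Φ Y ≈ firstColumnExpansion Y * Φ δ
  alternating≈firstColumnExpansion n ind Φ alt Y = begin
    Φ Y                                                           ≈⟨ linearInColumn zero Y (λ i → Y i zero) δ (λ r → sym (∑-δ (λ i → Y i zero) r)) ⟩
    sum (λ i → Y i zero * Φ (withColumn Y zero (δ i)))            ≈⟨ sum-cong-≋ {x = λ i → Y i zero * Φ (withColumn Y zero (δ i))}
                                                                                 {y = λ i → (- 1#) ^ toℕ i * (Y i zero * det R n (columnMinor i Y)) * Φ δ}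
                                                                                 summand ⟩
    sum (λ i → (- 1#) ^ toℕ i * (Y i zero * det R n (columnMinor i Y)) * Φ δ)
      ≈⟨ *-distribʳ-sum (Φ δ) (λ i → (- 1#) ^ toℕ i * (Y i zero * det R n (columnMinor i Y))) ⟨
    firstColumnExpansion Y * Φ δ                                  ∎
    where
    open IsAlternatingFormProperties alt using (linearInColumn)
    summand : ∀ i → Y i zero * Φ (withColumn Y zero (δ i)) ≈ (- 1#) ^ toℕ i * (Y i zero * det R n (columnMinor i Y)) * Φ δ
    summand i = begin
      Y i zero * Φ (withColumn Y zero (δ i))                      ≈⟨ *-congˡ (RowIndependence.rowIndependence alt i _ (extendAt i (columnMinor i Y))
                                                                         (withColumn-at Y zero (δ i)) (λ _ → refl) rowsAgree) ⟩
      Y i zero * Φ (extendAt i (columnMinor i Y))                 ≈⟨ *-congˡ (ind _ (extendAt-isAlternatingForm i alt) (columnMinor i Y)) ⟩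
      Y i zero * (det R n (columnMinor i Y) * Φ (extendAt i δ))   ≈⟨ *-congˡ (*-congˡ (extendAt-δ n i alt)) ⟩
      Y i zero * (det R n (columnMinor i Y) * ((- 1#) ^ toℕ i * Φ δ))
        ≈⟨ solve 4 (λ y d s φ → y :* (d :* (s :* φ)) := s :* (y :* d) :* φ) refl (Y i zero) _ _ _ ⟩
      (- 1#) ^ toℕ i * (Y i zero * det R n (columnMinor i Y)) * Φ δ ∎
      where
      rowsAgree : ∀ r j → r ≢ i → withColumn Y zero (δ i) r (suc j) ≈ extendAt i (columnMinor i Y) r (suc j)
      rowsAgree r j r≢i = trans (withColumn-off Y zero (δ i) r (suc j) (λ ()))
        (reflexive (≡.sym (≡.trans (insertAt-punchOut (λ r′ → Y (punchIn i r′) (suc j)) (r≢i ∘ ≡.sym))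
                                    (≡.cong (λ r → Y r (suc j)) (Fin.punchIn-punchOut (r≢i ∘ ≡.sym))))))

  isAlternatingForm⇒≈det* : ∀ n (Φ : Matrix n → Carrier) → IsAlternatingForm Φ → ∀ Y → Φ Y ≈ det R n Y * Φ δ
  det-firstColumnExpansion : ∀ n (Y : Matrix (suc n)) → det R (suc n) Y ≈ firstColumnExpansion Y

  isAlternatingForm⇒≈det* zero    Φ alt Y = trans (IsAlternatingForm.cong alt (λ ())) (sym (*-identityˡ _))
  isAlternatingForm⇒≈det* (suc n) Φ alt Y = begin
    Φ Y                           ≈⟨ alternating≈firstColumnExpansion n (isAlternatingForm⇒≈det* n) Φ alt Y ⟩
    firstColumnExpansion Y * Φ δ  ≈⟨ *-congʳ (det-firstColumnExpansion n Y) ⟨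
    det R (suc n) Y * Φ δ         ∎

  det-firstColumnExpansion n Y = begin
    det R (suc n) Y                          ≈⟨ alternating≈firstColumnExpansion n (isAlternatingForm⇒≈det* n) _ (det-isAlternatingForm (suc n)) Y ⟩
    firstColumnExpansion Y * det R (suc n) δ ≈⟨ *-congˡ (det-δ (suc n)) ⟩
    firstColumnExpansion Y * 1#              ≈⟨ *-identityʳ _ ⟩
    firstColumnExpansion Y                   ∎

  transpose : ∀ {n} → Matrix n → Matrix n
  transpose Y i j = Y j i

  det-transpose : ∀ n (Y : Matrix n) → det R n (transpose Y) ≈ det R n Y
  det-transpose zero    Y = refl
  det-transpose (suc n) Y = begin
    det R (suc n) (transpose Y)       ≈⟨ det-expand (transpose Y) ⟩
    sum (cofactorTerm (transpose Y))
      ≈⟨ sum-cong-≋ {x = cofactorTerm (transpose Y)} {y = λ i → (- 1#) ^ toℕ i * (Y i zero * det R n (columnMinor i Y))}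
                                                    (λ j → *-congˡ (*-congˡ (det-transpose n (columnMinor j Y)))) ⟩
    firstColumnExpansion Y            ≈⟨ det-firstColumnExpansion n Y ⟨
    det R (suc n) Y                   ∎

  infixl 7 _*ᴹ_
  _*ᴹ_ : ∀ {n} → Matrix n → Matrix n → Matrix n
  (X *ᴹ Y) i j = sum (λ l → X i l * Y l j)

  det-*ᴹ : ∀ n (X Y : Matrix n) → det R n (X *ᴹ Y) ≈ det R n X * det R n Y
  det-*ᴹ n X Y = begin
    det R n (X *ᴹ Y)           ≈⟨ isAlternatingForm⇒≈det* n (λ Z → det R n (X *ᴹ Z)) leftMultiple-isAlternatingForm Y ⟩
    det R n Y * det R n (X *ᴹ δ) ≈⟨ *-congˡ (det-cong n (λ i j → ∑-δ (X i) j)) ⟩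
    det R n Y * det R n X      ≈⟨ *-comm _ _ ⟩
    det R n X * det R n Y      ∎
    where
    column : ∀ (u v : Fin n → Carrier) → (∀ l → u l ≈ v l) → ∀ i → sum (λ l → X i l * u l) ≈ sum (λ l → X i l * v l)
    column u v u≈v i = sum-cong-≋ {x = λ l → X i l * u l} {y = λ l → X i l * v l} (λ l → *-congˡ (u≈v l))
    agree : ∀ {Z W : Matrix n} {c} → AgreeOutside c Z W → AgreeOutside c (X *ᴹ Z) (X *ᴹ W)
    agree {Z} {W} Z≈W i j j≢c = column (λ l → Z l j) (λ l → W l j) (λ l → Z≈W l j j≢c) i
    leftMultiple-isAlternatingForm : IsAlternatingForm (λ Z → det R n (X *ᴹ Z))
    leftMultiple-isAlternatingForm = record
      { cong        = λ {Z} {W} Z≈W → det-cong n (λ i j → column (λ l → Z l j) (λ l → W l j) (λ l → Z≈W l j) i)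
      ; additive    = λ c M A B M≈A M≈B Mc≈ → det-additive n c _ _ _ (agree M≈A) (agree M≈B)
                        (λ i → trans (column (λ l → M l c) (λ l → A l c + B l c) Mc≈ i)
                                     (trans (sum-cong-≋ {x = λ l → X i l * (A l c + B l c)} {y = λ l → X i l * A l c + X i l * B l c} (λ l → distribˡ _ _ _))
                                            (∑-distrib-+ (λ l → X i l * A l c) (λ l → X i l * B l c))))
      ; homogeneous = λ c α M A M≈A Mc≈ → det-homogeneous n c α _ _ (agree M≈A)
                        (λ i → trans (column (λ l → M l c) (λ l → α * A l c) Mc≈ i)
                                     (trans (sum-cong-≋ {x = λ l → X i l * (α * A l c)} {y = λ l → α * (X i l * A l c)}
                                                        (λ l → solve 3 (λ x a y → x :* (a :* y) := a :* (x :* y)) refl _ α _))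
                                            (sym (*-distribˡ-sum α (λ l → X i l * A l c)))))
      ; adjacent    = λ M c c′ c′≡1+c Mc≈Mc′ → det-adjacent n _ c c′ c′≡1+c (column (λ l → M l c) (λ l → M l c′) Mc≈Mc′)
      }

  det-lowerTriangular : ∀ n (M : Matrix n) → (∀ i j → toℕ i ℕ.< toℕ j → M i j ≈ 0#) → det R n M ≈ product (λ i → M i i)
  det-lowerTriangular zero    M M≈0 = refl
  det-lowerTriangular (suc n) M M≈0 = begin
    det R (suc n) M                                   ≈⟨ det-expand M ⟩
    cofactorTerm M zero + sum (λ j → cofactorTerm M (suc j))
      ≈⟨ +-cong (trans (*-identityˡ _) (*-congˡ (det-lowerTriangular n (minor zero M) (λ i j i<j → M≈0 (suc i) (suc j) (ℕ.s≤s i<j)))))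
                (∑-zero (λ j → cofactorTerm M (suc j)) (λ j → trans (*-congˡ (trans (*-congʳ (M≈0 zero (suc j) ℕ.z<s)) (zeroˡ _))) (zeroʳ _))) ⟩
    M zero zero * product (λ i → M (suc i) (suc i)) + 0# ≈⟨ +-identityʳ _ ⟩
    product (λ i → M i i)                             ∎

  det-upperTriangular : ∀ n (M : Matrix n) → (∀ i j → toℕ j ℕ.< toℕ i → M i j ≈ 0#) → det R n M ≈ product (λ i → M i i)
  det-upperTriangular n M M≈0 = trans (sym (det-transpose n M)) (det-lowerTriangular n (transpose M) (λ i j j<i → M≈0 j i j<i))

  diagonal : ∀ {n} → (Fin n → Carrier) → Matrix n
  diagonal d i j = δ i j * d j

  det-diagonal : ∀ n (d : Fin n → Carrier) → det R n (diagonal d) ≈ product d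
  det-diagonal n d = trans (det-lowerTriangular n (diagonal d) off-diagonal) (product-cong n on-diagonal)
    where
    off-diagonal : ∀ i j → toℕ i ℕ.< toℕ j → diagonal d i j ≈ 0#
    off-diagonal i j i<j = trans (*-congʳ (reflexive (δ-off i j (ℕ.<⇒≢ i<j ∘ ≡.cong toℕ)))) (zeroˡ _)
    on-diagonal : ∀ i → diagonal d i i ≈ d i
    on-diagonal i = trans (*-congʳ (reflexive (δ-diag i))) (*-identityˡ _)
    product-cong : ∀ n {f g : Fin n → Carrier} → (∀ i → f i ≈ g i) → product f ≈ product g
    product-cong zero    f≈g = refl
    product-cong (suc n) f≈g = *-cong (f≈g zero) (product-cong n (f≈g ∘ suc))

  *ᴹ-diagonal : ∀ {n} (W : Matrix n) (d : Fin n → Carrier) i j → (W *ᴹ diagonal d) i j ≈ W i j * d j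
  *ᴹ-diagonal W d i j = begin
    sum (λ l → W i l * (δ l j * d j))  ≈⟨ sum-cong-≋ {x = λ l → W i l * (δ l j * d j)} {y = λ l → W i l * δ l j * d j} (λ l → sym (*-assoc _ _ _)) ⟩
    sum (λ l → W i l * δ l j * d j)    ≈⟨ *-distribʳ-sum (d j) (λ l → W i l * δ l j) ⟨
    sum (λ l → W i l * δ l j) * d j    ≈⟨ *-congʳ (∑-δ (W i) j) ⟩
    W i j * d j                        ∎

module MonomialMatrices {ℓ₁ ℓ₂ : Level} (R : CommutativeRing ℓ₁ ℓ₂) where
  open CommutativeRing R hiding (zero)
  open IntegerCoefficients R using (solve; _:*_; _:=_)
  open Determinant R
  open import Algebra.Properties.CommutativeSemiring.Exp commutativeSemiring
    using (_^_; ^-congˡ; ^-homo-*; ^-distrib-*)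
  open import Algebra.Definitions.RawSemiring (Semiring.rawSemiring semiring) using (product; _×_)
  open import Algebra.Properties.Semiring.Mult semiring using (×-assoc-*; ×-homo-1; ×-congʳ)
  open import Algebra.Properties.Semiring.Sum semiring using (sum; sum-cong-≋; *-distribʳ-sum; sum-init-last)
  open import Algebra.Properties.CommutativeMonoid.Sum *-commutativeMonoid
    using () renaming (sum-cong-≋ to product-cong-≋; ∑-distrib-+ to ∏-distrib-*; sum-init-last to product-init-last)
  import Algebra.Properties.CommutativeSemiring.Binomial commutativeSemiring as Binomial
  open import Relation.Binary.Reasoning.Setoid setoid

  ∑ℕ : ℕ → (ℕ → Carrier) → Carrier
  ∑ℕ n f = sum (λ i → f (toℕ {n} i))

  ∏ℕ : ℕ → (ℕ → Carrier) → Carrier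
  ∏ℕ n f = product (λ i → f (toℕ {n} i))

  ∑ℕ-cong : ∀ n {f g : ℕ → Carrier} → (∀ k → k ℕ.< n → f k ≈ g k) → ∑ℕ n f ≈ ∑ℕ n g
  ∑ℕ-cong n {f} {g} f≈g = sum-cong-≋ {x = λ i → f (toℕ i)} {y = λ i → g (toℕ i)} (λ i → f≈g (toℕ i) (Fin.toℕ<n i))

  ∏ℕ-cong : ∀ n {f g : ℕ → Carrier} → (∀ k → k ℕ.< n → f k ≈ g k) → ∏ℕ n f ≈ ∏ℕ n g
  ∏ℕ-cong n {f} {g} f≈g = product-cong-≋ {x = λ i → f (toℕ i)} {y = λ i → g (toℕ i)} (λ i → f≈g (toℕ i) (Fin.toℕ<n i))

  ∑ℕ-last : ∀ n (f : ℕ → Carrier) → ∑ℕ (suc n) f ≈ ∑ℕ n f + f n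
  ∑ℕ-last n f = trans (sum-init-last (λ i → f (toℕ i)))
    (+-cong (sum-cong-≋ {n} {x = λ i → f (toℕ (Fin.inject₁ i))} {y = λ i → f (toℕ i)} (λ i → reflexive (≡.cong f (Fin.toℕ-inject₁ i))))
            (reflexive (≡.cong f (Fin.toℕ-fromℕ n))))

  ∏ℕ-last : ∀ n (f : ℕ → Carrier) → ∏ℕ (suc n) f ≈ ∏ℕ n f * f n
  ∏ℕ-last n f = trans (product-init-last (λ i → f (toℕ i)))
    (*-cong (product-cong-≋ {n} {x = λ i → f (toℕ (Fin.inject₁ i))} {y = λ i → f (toℕ i)} (λ i → reflexive (≡.cong f (Fin.toℕ-inject₁ i))))
            (reflexive (≡.cong f (Fin.toℕ-fromℕ n))))

  ∑ℕ-extend : ∀ a d (f : ℕ → Carrier) → (∀ k → a ℕ.≤ k → f k ≈ 0#) → ∑ℕ (d ℕ.+ a) f ≈ ∑ℕ a f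
  ∑ℕ-extend a zero    f f≈0 = refl
  ∑ℕ-extend a (suc d) f f≈0 = begin
    ∑ℕ (suc d ℕ.+ a) f           ≈⟨ ∑ℕ-last (d ℕ.+ a) f ⟩
    ∑ℕ (d ℕ.+ a) f + f (d ℕ.+ a) ≈⟨ +-cong (∑ℕ-extend a d f f≈0) (f≈0 (d ℕ.+ a) (ℕ.m≤n+m a d)) ⟩
    ∑ℕ a f + 0#                  ≈⟨ +-identityʳ _ ⟩
    ∑ℕ a f                       ∎

  ∑ℕ-reverse : ∀ n (f : ℕ → Carrier) → ∑ℕ (suc n) f ≈ ∑ℕ (suc n) (λ k → f (n ∸ k))
  ∑ℕ-reverse zero    f = refl
  ∑ℕ-reverse (suc n) f = begin
    f 0 + ∑ℕ (suc n) (f ∘ suc)                           ≈⟨ +-congˡ (∑ℕ-reverse n (f ∘ suc)) ⟩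
    f 0 + ∑ℕ (suc n) (λ k → f (suc (n ∸ k)))             ≈⟨ +-comm _ _ ⟩
    ∑ℕ (suc n) (λ k → f (suc (n ∸ k))) + f 0
      ≈⟨ +-congʳ (∑ℕ-cong (suc n) (λ k k<1+n → reflexive (≡.cong f (≡.sym (ℕ.+-∸-assoc 1 (ℕ.≤-pred k<1+n)))))) ⟩
    ∑ℕ (suc n) (λ k → f (suc n ∸ k)) + f 0               ≡⟨ ≡.cong (λ z → ∑ℕ (suc n) (λ k → f (suc n ∸ k)) + f z) (ℕ.n∸n≡0 (suc n)) ⟨
    ∑ℕ (suc n) (λ k → f (suc n ∸ k)) + f (suc n ∸ suc n) ≈⟨ ∑ℕ-last (suc n) (λ k → f (suc n ∸ k)) ⟨
    ∑ℕ (suc (suc n)) (λ k → f (suc n ∸ k))               ∎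

  monomial : ℕ → Carrier → Carrier → ℕ → Carrier
  monomial n a b l = a ^ l * b ^ (n ∸ l)

  binomial : ∀ n x y → (x + y) ^ n ≈ ∑ℕ (suc n) (λ k → (n C k) × 1# * monomial n x y k)
  binomial n x y = trans (Binomial.theorem n x y)
    (sum-cong-≋ {suc n} {x = λ k → (n C toℕ k) × monomial n x y (toℕ k)} {y = λ k → (n C toℕ k) × 1# * monomial n x y (toℕ k)}
                (λ k → sym (trans (×-assoc-* (n C toℕ k) 1# _) (×-congʳ (n C toℕ k) (*-identityˡ _)))))

  -- Matrix of the n-th symmetric power of (a , b) ↦ (p a + q b , r b) in the monomial basis.
  symPowerUpper : ℕ → Carrier → Carrier → Carrier → ℕ → ℕ → Carrier
  symPowerUpper n p q r l k = (l C k) × 1# * (p ^ k * (q ^ (l ∸ k) * r ^ (n ∸ l)))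

  monomial-upper : ∀ n p q r a b l → l ℕ.≤ n →
                   monomial n (p * a + q * b) (r * b) l ≈ ∑ℕ (suc n) (λ k → symPowerUpper n p q r l k * monomial n a b k)
  monomial-upper n p q r a b l l≤n = begin
    (p * a + q * b) ^ l * (r * b) ^ (n ∸ l)
      ≈⟨ *-congʳ (binomial l (p * a) (q * b)) ⟩
    ∑ℕ (suc l) (λ k → (l C k) × 1# * monomial l (p * a) (q * b) k) * (r * b) ^ (n ∸ l)
      ≈⟨ *-distribʳ-sum {suc l} ((r * b) ^ (n ∸ l)) (λ k → (l C toℕ k) × 1# * monomial l (p * a) (q * b) (toℕ k)) ⟩
    ∑ℕ (suc l) (λ k → (l C k) × 1# * monomial l (p * a) (q * b) k * (r * b) ^ (n ∸ l))
      ≈⟨ ∑ℕ-cong (suc l) (λ k k<1+l → term k (ℕ.≤-pred k<1+l)) ⟩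
    ∑ℕ (suc l) F
      ≈⟨ ∑ℕ-extend (suc l) (n ∸ l) F F≈0 ⟨
    ∑ℕ ((n ∸ l) ℕ.+ suc l) F
      ≡⟨ ≡.cong (λ z → ∑ℕ z F) (≡.trans (ℕ.+-suc (n ∸ l) l) (≡.cong suc (ℕ.m∸n+n≡m l≤n))) ⟩
    ∑ℕ (suc n) F ∎
    where
    F : ℕ → Carrier
    F k = symPowerUpper n p q r l k * monomial n a b k
    F≈0 : ∀ k → suc l ℕ.≤ k → F k ≈ 0#
    F≈0 k l<k rewrite k>n⇒nCk≡0 l<k = trans (*-congʳ (zeroˡ _)) (zeroˡ _)
    term : ∀ k → k ℕ.≤ l → (l C k) × 1# * monomial l (p * a) (q * b) k * (r * b) ^ (n ∸ l) ≈ F k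
    term k k≤l = begin
      c * ((p * a) ^ k * (q * b) ^ (l ∸ k)) * (r * b) ^ (n ∸ l)
        ≈⟨ *-cong (*-congˡ (*-cong (^-distrib-* p a k) (^-distrib-* q b (l ∸ k)))) (^-distrib-* r b (n ∸ l)) ⟩
      c * ((p ^ k * a ^ k) * (q ^ (l ∸ k) * b ^ (l ∸ k))) * (r ^ (n ∸ l) * b ^ (n ∸ l))
        ≈⟨ solve 7 (λ c pk ak ql bl rl bn → c :* ((pk :* ak) :* (ql :* bl)) :* (rl :* bn) := (c :* (pk :* (ql :* rl))) :* (ak :* (bl :* bn)))
                   refl c _ _ _ _ _ _ ⟩
      symPowerUpper n p q r l k * (a ^ k * (b ^ (l ∸ k) * b ^ (n ∸ l)))
        ≈⟨ *-congˡ (*-congˡ (trans (sym (^-homo-* b (l ∸ k) (n ∸ l))) (reflexive (≡.cong (b ^_) l-k+n-l≡n-k)))) ⟩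
      F k ∎
      where
      c : Carrier
      c = (l C k) × 1#
      l-k+n-l≡n-k : (l ∸ k) ℕ.+ (n ∸ l) ≡ n ∸ k
      l-k+n-l≡n-k = ≡.trans (ℕ.+-comm (l ∸ k) (n ∸ l)) (≡.trans (≡.sym (ℕ.+-∸-assoc (n ∸ l) k≤l)) (≡.cong (_∸ k) (ℕ.m∸n+n≡m l≤n)))

  symPowerLower : ℕ → Carrier → Carrier → Carrier → ℕ → ℕ → Carrier
  symPowerLower n μ κ λ′ l k = symPowerUpper n λ′ κ μ (n ∸ l) (n ∸ k)

  monomial-lower : ∀ n μ κ λ′ a b l → l ℕ.≤ n →
                   monomial n (μ * a) (κ * a + λ′ * b) l ≈ ∑ℕ (suc n) (λ k → symPowerLower n μ κ λ′ l k * monomial n a b k)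
  monomial-lower n μ κ λ′ a b l l≤n = begin
    (μ * a) ^ l * (κ * a + λ′ * b) ^ (n ∸ l)          ≈⟨ *-comm _ _ ⟩
    (κ * a + λ′ * b) ^ (n ∸ l) * (μ * a) ^ l
      ≈⟨ *-cong (^-congˡ (n ∸ l) (+-comm _ _)) (reflexive (≡.cong ((μ * a) ^_) (≡.sym (ℕ.m∸[m∸n]≡n l≤n)))) ⟩
    monomial n (λ′ * b + κ * a) (μ * a) (n ∸ l)        ≈⟨ monomial-upper n λ′ κ μ b a (n ∸ l) (ℕ.m∸n≤m n l) ⟩
    ∑ℕ (suc n) (λ k → symPowerUpper n λ′ κ μ (n ∸ l) k * monomial n b a k)
      ≈⟨ ∑ℕ-reverse n (λ k → symPowerUpper n λ′ κ μ (n ∸ l) k * monomial n b a k) ⟩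
    ∑ℕ (suc n) (λ k → symPowerUpper n λ′ κ μ (n ∸ l) (n ∸ k) * monomial n b a (n ∸ k))
      ≈⟨ ∑ℕ-cong (suc n) (λ k k<1+n → *-congˡ {symPowerUpper n λ′ κ μ (n ∸ l) (n ∸ k)} (swapped k (ℕ.≤-pred k<1+n))) ⟩
    ∑ℕ (suc n) (λ k → symPowerLower n μ κ λ′ l k * monomial n a b k) ∎
    where
    swapped : ∀ k → k ℕ.≤ n → monomial n b a (n ∸ k) ≈ monomial n a b k
    swapped k k≤n = trans (*-comm _ _) (*-congʳ (reflexive (≡.cong (a ^_) (ℕ.m∸[m∸n]≡n k≤n))))

  tabulateℕ : ∀ {n} → (ℕ → ℕ → Carrier) → Matrix n
  tabulateℕ F i j = F (toℕ i) (toℕ j)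

  det-symPowerUpper : ∀ n p q r → det R (suc n) (tabulateℕ (symPowerUpper n p q r)) ≈ ∏ℕ (suc n) (λ l → p ^ l * r ^ (n ∸ l))
  det-symPowerUpper n p q r = trans (det-lowerTriangular (suc n) _ above-diagonal)
                                    (∏ℕ-cong (suc n) (λ l _ → on-diagonal l))
    where
    above-diagonal : ∀ (i j : Fin (suc n)) → toℕ i ℕ.< toℕ j → symPowerUpper n p q r (toℕ i) (toℕ j) ≈ 0#
    above-diagonal i j i<j rewrite k>n⇒nCk≡0 i<j = zeroˡ _
    on-diagonal : ∀ l → symPowerUpper n p q r l l ≈ p ^ l * r ^ (n ∸ l)
    on-diagonal l rewrite nCn≡1 l | ℕ.n∸n≡0 l = trans (*-congʳ (×-homo-1 1#)) (trans (*-identityˡ _) (*-congˡ (*-identityˡ _)))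

  det-symPowerLower : ∀ n μ κ λ′ → det R (suc n) (tabulateℕ (symPowerLower n μ κ λ′)) ≈ ∏ℕ (suc n) (λ l → λ′ ^ (n ∸ l) * μ ^ l)
  det-symPowerLower n μ κ λ′ = trans (det-upperTriangular (suc n) _ below-diagonal)
                                     (∏ℕ-cong (suc n) (λ l l<1+n → on-diagonal l (ℕ.≤-pred l<1+n)))
    where
    below-diagonal : ∀ (i j : Fin (suc n)) → toℕ j ℕ.< toℕ i → symPowerLower n μ κ λ′ (toℕ i) (toℕ j) ≈ 0#
    below-diagonal i j j<i rewrite k>n⇒nCk≡0 (ℕ.∸-monoʳ-< j<i (ℕ.≤-pred (Fin.toℕ<n i))) = zeroˡ _
    on-diagonal : ∀ l → l ℕ.≤ n → symPowerLower n μ κ λ′ l l ≈ λ′ ^ (n ∸ l) * μ ^ l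
    on-diagonal l l≤n rewrite nCn≡1 (n ∸ l) | ℕ.n∸n≡0 (n ∸ l) | ℕ.m∸[m∸n]≡n l≤n =
      trans (*-congʳ (×-homo-1 1#)) (trans (*-identityˡ _) (*-congˡ (*-identityˡ _)))

  monomialMatrix : ∀ n → (ℕ → Carrier) → (ℕ → Carrier) → Matrix (suc n)
  monomialMatrix n x y l j = monomial n (x (toℕ j)) (y (toℕ j)) (toℕ l)

  det-monomialMatrix-zero : ∀ x y → det R 1 (monomialMatrix 0 x y) ≈ 1#
  det-monomialMatrix-zero x y = trans (+-identityʳ _) (trans (*-identityˡ _) (trans (*-identityʳ _) (*-identityˡ _)))

  1#^n≈1# : ∀ n → 1# ^ n ≈ 1#
  1#^n≈1# zero    = refl
  1#^n≈1# (suc n) = trans (*-identityˡ _) (1#^n≈1# n)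

  monomial-cong : ∀ n {a a′ b b′} l → a ≈ a′ → b ≈ b′ → monomial n a b l ≈ monomial n a′ b′ l
  monomial-cong n l a≈a′ b≈b′ = *-cong (^-congˡ l a≈a′) (^-congˡ (n ∸ l) b≈b′)

  module _ (p q r : Carrier) (x y : ℕ → Carrier) (x₀≈0 : x 0 ≈ 0#) (y₀≈1 : y 0 ≈ 1#)
           (x-step : ∀ j → x (suc j) ≈ p * x j + q * y j) (y-step : ∀ j → y (suc j) ≈ r * y j) where

    -- Only the top entry of the first column survives; the rest is the previous matrix, transformed by
    -- the triangular symPowerUpper and with column j scaled by x (j + 1).
    det-monomialMatrix-upper : ∀ n → det R (suc (suc n)) (monomialMatrix (suc n) x y) ≈
      det R (suc n) (monomialMatrix n x y) * (∏ℕ (suc n) (λ l → p ^ l * r ^ (n ∸ l)) * ∏ℕ (suc n) (λ j → x (suc j)))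
    det-monomialMatrix-upper n = begin
      det R (suc (suc n)) Y                                   ≈⟨ det-firstColumnExpansion (suc n) Y ⟩
      firstColumnExpansion Y                                  ≈⟨ ∑-single _ zero only-top ⟩
      1# * (Y zero zero * det R (suc n) (columnMinor zero Y))  ≈⟨ *-identityˡ _ ⟩
      Y zero zero * det R (suc n) (columnMinor zero Y)         ≈⟨ *-cong Y-top (det-cong (suc n) minor≈) ⟩
      1# * det R (suc n) ((S *ᴹ V) *ᴹ D)                       ≈⟨ *-identityˡ _ ⟩
      det R (suc n) ((S *ᴹ V) *ᴹ D)                            ≈⟨ det-*ᴹ (suc n) (S *ᴹ V) D ⟩
      det R (suc n) (S *ᴹ V) * det R (suc n) D                 ≈⟨ *-cong (det-*ᴹ (suc n) S V) (det-diagonal (suc n) (λ j → x (suc (toℕ j)))) ⟩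
      (det R (suc n) S * det R (suc n) V) * ∏ℕ (suc n) (λ j → x (suc j)) ≈⟨ *-congʳ (*-congʳ (det-symPowerUpper n p q r)) ⟩
      (∏ℕ (suc n) (λ l → p ^ l * r ^ (n ∸ l)) * det R (suc n) V) * ∏ℕ (suc n) (λ j → x (suc j))
        ≈⟨ solve 3 (λ a b c → (a :* b) :* c := b :* (a :* c)) refl _ _ _ ⟩
      det R (suc n) V * (∏ℕ (suc n) (λ l → p ^ l * r ^ (n ∸ l)) * ∏ℕ (suc n) (λ j → x (suc j))) ∎
      where
      Y : Matrix (suc (suc n))
      Y = monomialMatrix (suc n) x y
      V : Matrix (suc n)
      V = monomialMatrix n x y
      S : Matrix (suc n)
      S = tabulateℕ (symPowerUpper n p q r)
      D : Matrix (suc n)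
      D = diagonal (λ j → x (suc (toℕ j)))
      only-top : ∀ i → i ≢ zero → (- 1#) ^ toℕ i * (Y i zero * det R (suc n) (columnMinor i Y)) ≈ 0#
      only-top zero    0≢0 = ⊥-elim (0≢0 ≡.refl)
      only-top (suc i) _   = trans (*-congˡ (trans (*-congʳ Y-below) (zeroˡ _))) (zeroʳ _)
        where
        Y-below : Y (suc i) zero ≈ 0#
        Y-below = trans (*-congʳ (trans (*-congʳ x₀≈0) (zeroˡ _))) (zeroˡ _)
      Y-top : Y zero zero ≈ 1#
      Y-top = trans (*-identityˡ _) (trans (^-congˡ (suc n) y₀≈1) (1#^n≈1# (suc n)))
      minor≈ : ∀ l j → columnMinor zero Y l j ≈ ((S *ᴹ V) *ᴹ D) l j
      minor≈ l j = begin
        (x′ * x′ ^ toℕ l) * y′ ^ (n ∸ toℕ l)                         ≈⟨ solve 3 (λ a b c → (a :* b) :* c := (b :* c) :* a) refl _ _ _ ⟩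
        monomial n x′ y′ (toℕ l) * x′                               ≈⟨ *-congʳ (monomial-cong n (toℕ l) (x-step (toℕ j)) (y-step (toℕ j))) ⟩
        monomial n (p * x (toℕ j) + q * y (toℕ j)) (r * y (toℕ j)) (toℕ l) * x′
          ≈⟨ *-congʳ (monomial-upper n p q r (x (toℕ j)) (y (toℕ j)) (toℕ l) (ℕ.≤-pred (Fin.toℕ<n l))) ⟩
        (S *ᴹ V) l j * x′                                           ≈⟨ *ᴹ-diagonal (S *ᴹ V) (λ j → x (suc (toℕ j))) l j ⟨
        ((S *ᴹ V) *ᴹ D) l j                                         ∎
        where
        x′ : Carrier
        x′ = x (suc (toℕ j))
        y′ : Carrier
        y′ = y (suc (toℕ j))

  module _ (μ κ λ′ : Carrier) (x y : ℕ → Carrier) (x₀≈1 : x 0 ≈ 1#) (y₀≈0 : y 0 ≈ 0#)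
           (x-step : ∀ j → x (suc j) ≈ μ * x j) (y-step : ∀ j → y (suc j) ≈ κ * x j + λ′ * y j) where

    det-monomialMatrix-lower : ∀ n → det R (suc (suc n)) (monomialMatrix (suc n) x y) ≈
      (- 1#) ^ suc n * (det R (suc n) (monomialMatrix n x y) * (∏ℕ (suc n) (λ l → λ′ ^ (n ∸ l) * μ ^ l) * ∏ℕ (suc n) (λ j → y (suc j))))
    det-monomialMatrix-lower n = begin
      det R (suc (suc n)) Y                                   ≈⟨ det-firstColumnExpansion (suc n) Y ⟩
      firstColumnExpansion Y                                  ≈⟨ ∑-single _ last only-bottom ⟩
      (- 1#) ^ toℕ last * (Y last zero * det R (suc n) (columnMinor last Y))
        ≈⟨ *-cong (reflexive (≡.cong ((- 1#) ^_) (Fin.toℕ-fromℕ (suc n)))) (*-cong Y-bottom (det-cong (suc n) minor≈)) ⟩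
      s * (1# * det R (suc n) ((S *ᴹ V) *ᴹ D))                ≈⟨ *-congˡ (*-identityˡ _) ⟩
      s * det R (suc n) ((S *ᴹ V) *ᴹ D)                        ≈⟨ *-congˡ (det-*ᴹ (suc n) (S *ᴹ V) D) ⟩
      s * (det R (suc n) (S *ᴹ V) * det R (suc n) D)
        ≈⟨ *-congˡ (*-cong (det-*ᴹ (suc n) S V) (det-diagonal (suc n) (λ j → y (suc (toℕ j))))) ⟩
      s * ((det R (suc n) S * det R (suc n) V) * ∏ℕ (suc n) (λ j → y (suc j))) ≈⟨ *-congˡ (*-congʳ (*-congʳ (det-symPowerLower n μ κ λ′))) ⟩
      s * ((∏ℕ (suc n) (λ l → λ′ ^ (n ∸ l) * μ ^ l) * det R (suc n) V) * ∏ℕ (suc n) (λ j → y (suc j)))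
        ≈⟨ *-congˡ (solve 3 (λ a b c → (a :* b) :* c := b :* (a :* c)) refl _ _ _) ⟩
      s * (det R (suc n) V * (∏ℕ (suc n) (λ l → λ′ ^ (n ∸ l) * μ ^ l) * ∏ℕ (suc n) (λ j → y (suc j)))) ∎
      where
      s : Carrier
      s = (- 1#) ^ suc n
      Y : Matrix (suc (suc n))
      Y = monomialMatrix (suc n) x y
      V : Matrix (suc n)
      V = monomialMatrix n x y
      S : Matrix (suc n)
      S = tabulateℕ (symPowerLower n μ κ λ′)
      D : Matrix (suc n)
      D = diagonal (λ j → y (suc (toℕ j)))
      last : Fin (suc (suc n))
      last = Fin.fromℕ (suc n)
      only-bottom : ∀ i → i ≢ last → (- 1#) ^ toℕ i * (Y i zero * det R (suc n) (columnMinor i Y)) ≈ 0#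
      only-bottom i i≢last = trans (*-congˡ (trans (*-congʳ Y-above) (zeroˡ _))) (zeroʳ _)
        where
        i<1+n : toℕ i ℕ.< suc n
        i<1+n = ℕ.≤∧≢⇒< (ℕ.≤-pred (Fin.toℕ<n i)) (λ i≡1+n → i≢last (Fin.toℕ-injective (≡.trans i≡1+n (≡.sym (Fin.toℕ-fromℕ (suc n))))))
        Y-above : Y i zero ≈ 0#
        Y-above = trans (*-congˡ (trans (reflexive (≡.cong (y 0 ^_) (ℕ.+-∸-assoc 1 (ℕ.≤-pred i<1+n)))) (trans (*-congʳ y₀≈0) (zeroˡ _)))) (zeroʳ _)
      Y-bottom : Y last zero ≈ 1#
      Y-bottom = trans (*-cong (trans (^-congˡ (toℕ last) x₀≈1) (1#^n≈1# (toℕ last)))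
                               (reflexive (≡.cong (y 0 ^_) (≡.trans (≡.cong (suc n ∸_) (Fin.toℕ-fromℕ (suc n))) (ℕ.n∸n≡0 (suc n))))))
                       (*-identityˡ _)
      minor≈ : ∀ l j → columnMinor last Y l j ≈ ((S *ᴹ V) *ᴹ D) l j
      minor≈ l j = begin
        x′ ^ toℕ (Fin.punchIn last l) * y′ ^ (suc n ∸ toℕ (Fin.punchIn last l))
          ≡⟨ ≡.cong (λ k → x′ ^ k * y′ ^ (suc n ∸ k)) (toℕ-punchIn-< last l (≡.subst (toℕ l ℕ.<_) (≡.sym (Fin.toℕ-fromℕ (suc n))) (Fin.toℕ<n l))) ⟩
        x′ ^ toℕ l * y′ ^ (suc n ∸ toℕ l)            ≡⟨ ≡.cong (λ k → x′ ^ toℕ l * y′ ^ k) (ℕ.+-∸-assoc 1 (ℕ.≤-pred (Fin.toℕ<n l))) ⟩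
        x′ ^ toℕ l * (y′ * y′ ^ (n ∸ toℕ l))          ≈⟨ solve 3 (λ a b c → a :* (b :* c) := (a :* c) :* b) refl _ _ _ ⟩
        monomial n x′ y′ (toℕ l) * y′                ≈⟨ *-congʳ (monomial-cong n (toℕ l) (x-step (toℕ j)) (y-step (toℕ j))) ⟩
        monomial n (μ * x (toℕ j)) (κ * x (toℕ j) + λ′ * y (toℕ j)) (toℕ l) * y′
          ≈⟨ *-congʳ (monomial-lower n μ κ λ′ (x (toℕ j)) (y (toℕ j)) (toℕ l) (ℕ.≤-pred (Fin.toℕ<n l))) ⟩
        (S *ᴹ V) l j * y′                            ≈⟨ *ᴹ-diagonal (S *ᴹ V) (λ j → y (suc (toℕ j))) l j ⟨
        ((S *ᴹ V) *ᴹ D) l j                          ∎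
        where
        x′ : Carrier
        x′ = x (suc (toℕ j))
        y′ : Carrier
        y′ = y (suc (toℕ j))

  ∏ℕ-const : ∀ n a → ∏ℕ n (λ _ → a) ≈ a ^ n
  ∏ℕ-const zero    a = refl
  ∏ℕ-const (suc n) a = *-congˡ (∏ℕ-const n a)

  ∏ℕ-distrib-* : ∀ n (f g : ℕ → Carrier) → ∏ℕ n (λ k → f k * g k) ≈ ∏ℕ n f * ∏ℕ n g
  ∏ℕ-distrib-* n f g = ∏-distrib-* (λ i → f (toℕ {n} i)) (λ i → g (toℕ i))

  [2+n]C2 : ∀ n → suc (suc n) C 2 ≡ suc n ℕ.+ suc n C 2
  [2+n]C2 n = ≡.trans (≡.sym (nCk+nC[k+1]≡[n+1]C[k+1] (suc n) 1)) (≡.cong (ℕ._+ (suc n C 2)) (nC1≡n (suc n)))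

  ∏-monomial : ∀ n a b → ∏ℕ (suc n) (λ l → a ^ l * b ^ (n ∸ l)) ≈ (a * b) ^ (suc n C 2)
  ∏-monomial zero    a b = trans (*-identityʳ _) (*-identityˡ _)
  ∏-monomial (suc n) a b = begin
    (1# * b ^ suc n) * ∏ℕ (suc n) (λ l → a ^ suc l * b ^ (n ∸ l))
      ≈⟨ *-cong (*-identityˡ _) (trans (∏ℕ-cong (suc n) (λ l _ → *-assoc a (a ^ l) (b ^ (n ∸ l))))
                                       (∏ℕ-distrib-* (suc n) (λ _ → a) (λ l → a ^ l * b ^ (n ∸ l)))) ⟩
    b ^ suc n * (∏ℕ (suc n) (λ _ → a) * ∏ℕ (suc n) (λ l → a ^ l * b ^ (n ∸ l)))
      ≈⟨ *-congˡ (*-cong (∏ℕ-const (suc n) a) (∏-monomial n a b)) ⟩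
    b ^ suc n * (a ^ suc n * (a * b) ^ (suc n C 2))   ≈⟨ *-assoc _ _ _ ⟨
    (b ^ suc n * a ^ suc n) * (a * b) ^ (suc n C 2)   ≈⟨ *-congʳ (trans (*-comm _ _) (sym (^-distrib-* a b (suc n)))) ⟩
    (a * b) ^ suc n * (a * b) ^ (suc n C 2)           ≈⟨ ^-homo-* (a * b) (suc n) (suc n C 2) ⟨
    (a * b) ^ (suc n ℕ.+ suc n C 2)                   ≡⟨ ≡.cong ((a * b) ^_) ([2+n]C2 n) ⟨
    (a * b) ^ (suc (suc n) C 2)                       ∎

  module HankelOfPowers (λ′ μ κ α β γ : Carrier) (A f : ℕ → Carrier)
    (A₀≈0         : A 0 ≈ 0#)
    (A-step-lower : ∀ i → A (suc i) ≈ κ * μ ^ i + λ′ * A i)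
    (A-step-upper : ∀ j → A (suc j) ≈ μ * A j + κ * λ′ ^ j)
    (f-shift      : ∀ i j → f (i ℕ.+ j) ≈ μ ^ i * f j + A i * (β * λ′ ^ j))
    (f-split      : ∀ j → f j ≈ α * A j + γ * λ′ ^ j)
    where

    VL VU : ∀ m → Matrix (suc m)
    VL m = monomialMatrix m (μ ^_) A
    VU m = monomialMatrix m A (λ′ ^_)

    Q Ap : ℕ → Carrier
    Q m  = ∏ℕ (suc m) (λ j → A (suc j))
    Ap m = ∏ℕ (suc m) (λ i → A (suc i) ^ (2 ℕ.* (m ∸ i)))

    Ap-step : ∀ m → Ap (suc m) ≈ Ap m * (Q m * Q m)
    Ap-step m = begin
      Ap (suc m)                                   ≈⟨ ∏ℕ-last (suc m) g ⟩
      ∏ℕ (suc m) g * g (suc m)                     ≡⟨ ≡.cong (λ k → ∏ℕ (suc m) g * A (suc (suc m)) ^ (2 ℕ.* k)) (ℕ.n∸n≡0 (suc m)) ⟩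
      ∏ℕ (suc m) g * 1#                            ≈⟨ *-identityʳ _ ⟩
      ∏ℕ (suc m) g                                 ≈⟨ ∏ℕ-cong (suc m) (λ i i<1+m → g≈ i (ℕ.≤-pred i<1+m)) ⟩
      ∏ℕ (suc m) (λ i → A (suc i) ^ (2 ℕ.* (m ∸ i)) * (A (suc i) * A (suc i)))
        ≈⟨ ∏ℕ-distrib-* (suc m) (λ i → A (suc i) ^ (2 ℕ.* (m ∸ i))) (λ i → A (suc i) * A (suc i)) ⟩
      Ap m * ∏ℕ (suc m) (λ i → A (suc i) * A (suc i)) ≈⟨ *-congˡ (∏ℕ-distrib-* (suc m) (λ i → A (suc i)) (λ i → A (suc i))) ⟩
      Ap m * (Q m * Q m)                           ∎
      where
      g : ℕ → Carrier
      g i = A (suc i) ^ (2 ℕ.* (suc m ∸ i))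
      g≈ : ∀ i → i ℕ.≤ m → g i ≈ A (suc i) ^ (2 ℕ.* (m ∸ i)) * (A (suc i) * A (suc i))
      g≈ i i≤m = begin
        A (suc i) ^ (2 ℕ.* (suc m ∸ i))                   ≡⟨ ≡.cong (λ k → A (suc i) ^ (2 ℕ.* k)) (ℕ.+-∸-assoc 1 i≤m) ⟩
        A (suc i) ^ (2 ℕ.* suc (m ∸ i))                   ≡⟨ ≡.cong (A (suc i) ^_) (≡.trans (ℕ.*-suc 2 (m ∸ i)) (ℕ.+-comm 2 (2 ℕ.* (m ∸ i)))) ⟩
        A (suc i) ^ (2 ℕ.* (m ∸ i) ℕ.+ 2)                 ≈⟨ ^-homo-* (A (suc i)) (2 ℕ.* (m ∸ i)) 2 ⟩
        A (suc i) ^ (2 ℕ.* (m ∸ i)) * (A (suc i) * (A (suc i) * 1#)) ≈⟨ *-congˡ (*-congˡ (*-identityʳ _)) ⟩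
        A (suc i) ^ (2 ℕ.* (m ∸ i)) * (A (suc i) * A (suc i)) ∎

    det-VL-VU : ∀ m → det R (suc m) (VL m) * det R (suc m) (VU m) ≈
                      (- 1#) ^ (suc m C 2) * ((μ * λ′) ^ (2 ℕ.* (suc m C 3)) * Ap m)
    det-VL-VU zero = trans (*-cong (det-monomialMatrix-zero (μ ^_) A) (det-monomialMatrix-zero A (λ′ ^_)))
                           (trans (*-identityˡ 1#) (sym (trans (*-identityˡ _) (trans (*-identityˡ _) (*-identityʳ _)))))
    det-VL-VU (suc m) = begin
      det R (suc (suc m)) (VL (suc m)) * det R (suc (suc m)) (VU (suc m))
        ≈⟨ *-cong (det-monomialMatrix-lower μ κ λ′ (μ ^_) A refl A₀≈0 (λ _ → refl) A-step-lower m)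
                  (det-monomialMatrix-upper μ κ λ′ A (λ′ ^_) A₀≈0 refl A-step-upper (λ _ → refl) m) ⟩
      (s * (dL * (TL * Q m))) * (dU * (TU * Q m))
        ≈⟨ *-cong (*-congˡ (*-congˡ (*-congʳ TL≈T))) (*-congˡ (*-congʳ (∏-monomial m μ λ′))) ⟩
      (s * (dL * (T * Q m))) * (dU * (T * Q m))
        ≈⟨ solve 5 (λ s a b t q → (s :* (a :* (t :* q))) :* (b :* (t :* q)) := s :* ((a :* b) :* ((t :* t) :* (q :* q)))) refl _ _ _ _ _ ⟩
      s * ((dL * dU) * ((T * T) * (Q m * Q m)))    ≈⟨ *-congˡ (*-congʳ (det-VL-VU m)) ⟩
      s * (((- 1#) ^ (suc m C 2) * ((μ * λ′) ^ (2 ℕ.* (suc m C 3)) * Ap m)) * ((T * T) * (Q m * Q m)))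
        ≈⟨ solve 7 (λ s s₂ p ap t₁ t₂ q → s :* ((s₂ :* (p :* ap)) :* ((t₁ :* t₂) :* q)) := (s :* s₂) :* (((t₁ :* t₂) :* p) :* (ap :* q))) refl _ _ _ _ _ _ _ ⟩
      (s * (- 1#) ^ (suc m C 2)) * (((T * T) * (μ * λ′) ^ (2 ℕ.* (suc m C 3))) * (Ap m * (Q m * Q m)))
        ≈⟨ *-cong sign-step (*-cong power-step (Ap-step m)) ⟨
      (- 1#) ^ (suc (suc m) C 2) * ((μ * λ′) ^ (2 ℕ.* (suc (suc m) C 3)) * Ap (suc m)) ∎
      where
      s : Carrier
      s = (- 1#) ^ suc m
      dL : Carrier
      dL = det R (suc m) (VL m)
      dU : Carrier
      dU = det R (suc m) (VU m)
      TL : Carrier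
      TL = ∏ℕ (suc m) (λ l → λ′ ^ (m ∸ l) * μ ^ l)
      TU : Carrier
      TU = ∏ℕ (suc m) (λ l → μ ^ l * λ′ ^ (m ∸ l))
      T : Carrier
      T = (μ * λ′) ^ (suc m C 2)
      TL≈T : TL ≈ T
      TL≈T = trans (∏ℕ-cong (suc m) (λ l _ → *-comm (λ′ ^ (m ∸ l)) (μ ^ l))) (∏-monomial m μ λ′)
      sign-step : (- 1#) ^ (suc (suc m) C 2) ≈ s * (- 1#) ^ (suc m C 2)
      sign-step = trans (reflexive (≡.cong ((- 1#) ^_) ([2+n]C2 m))) (^-homo-* (- 1#) (suc m) (suc m C 2))
      power-step : (μ * λ′) ^ (2 ℕ.* (suc (suc m) C 3)) ≈ (T * T) * (μ * λ′) ^ (2 ℕ.* (suc m C 3))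
      power-step = begin
        (μ * λ′) ^ (2 ℕ.* (suc (suc m) C 3))                       ≡⟨ ≡.cong (λ k → (μ * λ′) ^ (2 ℕ.* k)) (nCk+nC[k+1]≡[n+1]C[k+1] (suc m) 2) ⟨
        (μ * λ′) ^ (2 ℕ.* (suc m C 2 ℕ.+ suc m C 3))               ≡⟨ ≡.cong ((μ * λ′) ^_) (ℕ.*-distribˡ-+ 2 (suc m C 2) (suc m C 3)) ⟩
        (μ * λ′) ^ (2 ℕ.* (suc m C 2) ℕ.+ 2 ℕ.* (suc m C 3))       ≈⟨ ^-homo-* (μ * λ′) (2 ℕ.* (suc m C 2)) (2 ℕ.* (suc m C 3)) ⟩
        (μ * λ′) ^ (2 ℕ.* (suc m C 2)) * (μ * λ′) ^ (2 ℕ.* (suc m C 3))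
          ≈⟨ *-congʳ (trans (reflexive (≡.cong ((μ * λ′) ^_) (≡.cong (suc m C 2 ℕ.+_) (ℕ.+-identityʳ (suc m C 2))))) (^-homo-* (μ * λ′) (suc m C 2) (suc m C 2))) ⟩
        (T * T) * (μ * λ′) ^ (2 ℕ.* (suc m C 3))                   ∎

    binomialDiagonal : ∀ m → Matrix (suc m)
    binomialDiagonal m = diagonal (λ l → (m C toℕ l) × 1#)

    symPowerMatrix : ∀ m → Matrix (suc m)
    symPowerMatrix m = tabulateℕ (symPowerUpper m α γ β)

    -- The binomial theorem applied to f (i + j) = μ ^ i f j + A i (β λ′ ^ j), then to f j = α A j + γ λ′ ^ j.
    hankel-factorization : ∀ m i j → f (toℕ i ℕ.+ toℕ j) ^ m ≈
                           ((transpose (VL m) *ᴹ binomialDiagonal m) *ᴹ (symPowerMatrix m *ᴹ VU m)) i j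
    hankel-factorization m i j = begin
      f (a ℕ.+ b) ^ m                                                      ≈⟨ ^-congˡ m (f-shift a b) ⟩
      (μ ^ a * f b + A a * (β * λ′ ^ b)) ^ m                               ≈⟨ binomial m _ _ ⟩
      ∑ℕ (suc m) (λ l → (m C l) × 1# * monomial m (μ ^ a * f b) (A a * (β * λ′ ^ b)) l)
        ≈⟨ ∑ℕ-cong (suc m) (λ l l<1+m → term l (ℕ.≤-pred l<1+m)) ⟩
      ∑ℕ (suc m) (λ l → (monomial m (μ ^ a) (A a) l * (m C l) × 1#) * ∑ℕ (suc m) (λ k → symPowerUpper m α γ β l k * monomial m (A b) (λ′ ^ b) k))
        ≈⟨ sum-cong-≋ {suc m} {x = λ l → (monomial m (μ ^ a) (A a) (toℕ l) * (m C toℕ l) × 1#) * Y l j} {y = λ l → X i l * Y l j}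
                      (λ l → *-congʳ (sym (*ᴹ-diagonal (transpose (VL m)) (λ l → (m C toℕ l) × 1#) i l))) ⟩
      (X *ᴹ Y) i j                                                         ∎
      where
      X Y : Matrix (suc m)
      X = transpose (VL m) *ᴹ binomialDiagonal m
      Y = symPowerMatrix m *ᴹ VU m
      a : ℕ
      a = toℕ i
      b : ℕ
      b = toℕ j
      term : ∀ l → l ℕ.≤ m → (m C l) × 1# * monomial m (μ ^ a * f b) (A a * (β * λ′ ^ b)) l ≈
             (monomial m (μ ^ a) (A a) l * (m C l) × 1#) * ∑ℕ (suc m) (λ k → symPowerUpper m α γ β l k * monomial m (A b) (λ′ ^ b) k)
      term l l≤m = begin
        c′ * ((μ ^ a * f b) ^ l * (A a * (β * λ′ ^ b)) ^ (m ∸ l))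
          ≈⟨ *-congˡ (*-cong (^-distrib-* _ _ l) (^-distrib-* _ _ (m ∸ l))) ⟩
        c′ * (((μ ^ a) ^ l * f b ^ l) * (A a ^ (m ∸ l) * (β * λ′ ^ b) ^ (m ∸ l)))
          ≈⟨ solve 5 (λ c x y u v → c :* ((x :* y) :* (u :* v)) := ((x :* u) :* c) :* (y :* v)) refl _ _ _ _ _ ⟩
        (monomial m (μ ^ a) (A a) l * c′) * monomial m (f b) (β * λ′ ^ b) l
          ≈⟨ *-congˡ (monomial-cong m l (f-split b) refl) ⟩
        (monomial m (μ ^ a) (A a) l * c′) * monomial m (α * A b + γ * λ′ ^ b) (β * λ′ ^ b) l
          ≈⟨ *-congˡ (monomial-upper m α γ β (A b) (λ′ ^ b) l l≤m) ⟩
        (monomial m (μ ^ a) (A a) l * c′) * ∑ℕ (suc m) (λ k → symPowerUpper m α γ β l k * monomial m (A b) (λ′ ^ b) k) ∎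
        where
        c′ : Carrier
        c′ = (m C l) × 1#

    det-hankel : ∀ m → det R (suc m) (λ i j → f (toℕ i ℕ.+ toℕ j) ^ m) ≈
      (- 1#) ^ (suc m C 2) * ((α * β) ^ (suc m C 2) * ((μ * λ′) ^ (2 ℕ.* (suc m C 3)) *
        ∏ℕ (suc m) (λ i → (m C i) × 1# * A (suc i) ^ (2 ℕ.* (m ∸ i)))))
    det-hankel m = begin
      det R (suc m) (λ i j → f (toℕ i ℕ.+ toℕ j) ^ m)        ≈⟨ det-cong (suc m) (hankel-factorization m) ⟩
      det R (suc m) (X *ᴹ Y)                                  ≈⟨ det-*ᴹ (suc m) X Y ⟩
      det R (suc m) X * det R (suc m) Y                       ≈⟨ *-cong (det-*ᴹ (suc m) (transpose (VL m)) D) (det-*ᴹ (suc m) S (VU m)) ⟩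
      (det R (suc m) (transpose (VL m)) * det R (suc m) D) * (det R (suc m) S * det R (suc m) (VU m))
        ≈⟨ *-cong (*-cong (det-transpose (suc m) (VL m)) (det-diagonal (suc m) (λ l → (m C toℕ l) × 1#)))
                  (*-congʳ (trans (det-symPowerUpper m α γ β) (∏-monomial m α β))) ⟩
      (det R (suc m) (VL m) * c) * ((α * β) ^ (suc m C 2) * det R (suc m) (VU m))
        ≈⟨ solve 4 (λ a c p b → (a :* c) :* (p :* b) := p :* (c :* (a :* b))) refl _ _ _ _ ⟩
      (α * β) ^ (suc m C 2) * (c * (det R (suc m) (VL m) * det R (suc m) (VU m))) ≈⟨ *-congˡ (*-congˡ (det-VL-VU m)) ⟩
      (α * β) ^ (suc m C 2) * (c * ((- 1#) ^ (suc m C 2) * ((μ * λ′) ^ (2 ℕ.* (suc m C 3)) * Ap m)))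
        ≈⟨ solve 5 (λ p c s q a → p :* (c :* (s :* (q :* a))) := s :* (p :* (q :* (c :* a)))) refl _ _ _ _ _ ⟩
      (- 1#) ^ (suc m C 2) * ((α * β) ^ (suc m C 2) * ((μ * λ′) ^ (2 ℕ.* (suc m C 3)) * (c * Ap m)))
        ≈⟨ *-congˡ (*-congˡ (*-congˡ (∏ℕ-distrib-* (suc m) (λ l → (m C l) × 1#) (λ i → A (suc i) ^ (2 ℕ.* (m ∸ i)))))) ⟨
      (- 1#) ^ (suc m C 2) * ((α * β) ^ (suc m C 2) * ((μ * λ′) ^ (2 ℕ.* (suc m C 3)) *
        ∏ℕ (suc m) (λ i → (m C i) × 1# * A (suc i) ^ (2 ℕ.* (m ∸ i))))) ∎
      where
      S D X Y : Matrix (suc m)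
      S = symPowerMatrix m
      D = binomialDiagonal m
      X = transpose (VL m) *ᴹ D
      Y = S *ᴹ VU m
      c : Carrier
      c = ∏ℕ (suc m) (λ l → (m C l) × 1#)

-- R[t] / (t² - s t - c), with elements u₁ + u₂ t represented as pairs (u₁ , u₂).
module QuadraticExtension {ℓ₁ ℓ₂ : Level} (R : CommutativeRing ℓ₁ ℓ₂) (s c : CommutativeRing.Carrier R) where
  open CommutativeRing R
  open IntegerCoefficients R using (solve; _:+_; _:*_; :-_; _:=_; con)
  open Algebra.Properties.Ring ring using (-0#≈0#)

  Carrier′ : Set ℓ₁
  Carrier′ = Carrier Product.× Carrier

  infix  4 _≈′_
  infixl 6 _+′_
  infixl 7 _*′_

  -- Opaque, so that unification in the extension does not unfold into the components.
  opaque
    _≈′_ : Carrier′ → Carrier′ → Set ℓ₂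
    (u₁ , u₂) ≈′ (v₁ , v₂) = (u₁ ≈ v₁) Product.× (u₂ ≈ v₂)

    _+′_ _*′_ : Carrier′ → Carrier′ → Carrier′
    (u₁ , u₂) +′ (v₁ , v₂) = (u₁ + v₁ , u₂ + v₂)
    (u₁ , u₂) *′ (v₁ , v₂) = (u₁ * v₁ + c * (u₂ * v₂) , u₁ * v₂ + u₂ * v₁ + s * (u₂ * v₂))

    -′_ : Carrier′ → Carrier′
    -′ (u₁ , u₂) = (- u₁ , - u₂)

    ι : Carrier → Carrier′
    ι u = (u , 0#)

    t t̄ : Carrier′
    t = (0# , 1#)
    t̄ = (s , - 1#)

  opaque
    unfolding _≈′_ _+′_ _*′_ -′_ ι t t̄

    ≈′-isEquivalence : IsEquivalence _≈′_
    ≈′-isEquivalence = record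
      { refl  = refl , refl
      ; sym   = Product.map sym sym
      ; trans = Product.zip trans trans }

    +′-cong : ∀ {x y u v} → x ≈′ y → u ≈′ v → x +′ u ≈′ y +′ v
    +′-cong = Product.zip +-cong +-cong

    +′-assoc : ∀ x y z → x +′ y +′ z ≈′ x +′ (y +′ z)
    +′-assoc (x₁ , x₂) (y₁ , y₂) (z₁ , z₂) = +-assoc x₁ y₁ z₁ , +-assoc x₂ y₂ z₂

    +′-identity : (∀ x → ι 0# +′ x ≈′ x) Product.× (∀ x → x +′ ι 0# ≈′ x)
    +′-identity = (λ (x₁ , x₂) → +-identityˡ x₁ , +-identityˡ x₂) , (λ (x₁ , x₂) → +-identityʳ x₁ , +-identityʳ x₂)

    -′-inverse : (∀ x → -′ x +′ x ≈′ ι 0#) Product.× (∀ x → x +′ -′ x ≈′ ι 0#)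
    -′-inverse = (λ (x₁ , x₂) → -‿inverseˡ x₁ , -‿inverseˡ x₂) , (λ (x₁ , x₂) → -‿inverseʳ x₁ , -‿inverseʳ x₂)

    -′-cong : ∀ {x y} → x ≈′ y → -′ x ≈′ -′ y
    -′-cong = Product.map -‿cong -‿cong

    +′-comm : ∀ x y → x +′ y ≈′ y +′ x
    +′-comm (x₁ , x₂) (y₁ , y₂) = +-comm x₁ y₁ , +-comm x₂ y₂

    *′-cong : ∀ {x y u v} → x ≈′ y → u ≈′ v → x *′ u ≈′ y *′ v
    *′-cong (x₁≈y₁ , x₂≈y₂) (u₁≈v₁ , u₂≈v₂) =
        +-cong (*-cong x₁≈y₁ u₁≈v₁) (*-congˡ (*-cong x₂≈y₂ u₂≈v₂))
      , +-cong (+-cong (*-cong x₁≈y₁ u₂≈v₂) (*-cong x₂≈y₂ u₁≈v₁)) (*-congˡ (*-cong x₂≈y₂ u₂≈v₂))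

    *′-assoc : ∀ x y z → x *′ y *′ z ≈′ x *′ (y *′ z)
    *′-assoc (x₁ , x₂) (y₁ , y₂) (z₁ , z₂) =
        solve 8 (λ x₁ x₂ y₁ y₂ z₁ z₂ s c →
                  (x₁ :* y₁ :+ c :* (x₂ :* y₂)) :* z₁ :+ c :* ((x₁ :* y₂ :+ x₂ :* y₁ :+ s :* (x₂ :* y₂)) :* z₂)
               := x₁ :* (y₁ :* z₁ :+ c :* (y₂ :* z₂)) :+ c :* (x₂ :* (y₁ :* z₂ :+ y₂ :* z₁ :+ s :* (y₂ :* z₂))))
                refl x₁ x₂ y₁ y₂ z₁ z₂ s c
      , solve 8 (λ x₁ x₂ y₁ y₂ z₁ z₂ s c →
                  (x₁ :* y₁ :+ c :* (x₂ :* y₂)) :* z₂ :+ (x₁ :* y₂ :+ x₂ :* y₁ :+ s :* (x₂ :* y₂)) :* z₁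
                    :+ s :* ((x₁ :* y₂ :+ x₂ :* y₁ :+ s :* (x₂ :* y₂)) :* z₂)
               := x₁ :* (y₁ :* z₂ :+ y₂ :* z₁ :+ s :* (y₂ :* z₂)) :+ x₂ :* (y₁ :* z₁ :+ c :* (y₂ :* z₂))
                    :+ s :* (x₂ :* (y₁ :* z₂ :+ y₂ :* z₁ :+ s :* (y₂ :* z₂))))
                refl x₁ x₂ y₁ y₂ z₁ z₂ s c

    *′-identity : (∀ x → ι 1# *′ x ≈′ x) Product.× (∀ x → x *′ ι 1# ≈′ x)
    *′-identity = (λ (x₁ , x₂) → solve 3 (λ x₁ x₂ c → con (+ 1) :* x₁ :+ c :* (con (+ 0) :* x₂) := x₁) refl x₁ x₂ c
                               , solve 3 (λ x₁ x₂ s → con (+ 1) :* x₂ :+ con (+ 0) :* x₁ :+ s :* (con (+ 0) :* x₂) := x₂) refl x₁ x₂ s)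
                , (λ (x₁ , x₂) → solve 3 (λ x₁ x₂ c → x₁ :* con (+ 1) :+ c :* (x₂ :* con (+ 0)) := x₁) refl x₁ x₂ c
                               , solve 3 (λ x₁ x₂ s → x₁ :* con (+ 0) :+ x₂ :* con (+ 1) :+ s :* (x₂ :* con (+ 0)) := x₂) refl x₁ x₂ s)

    *′-distrib-+′ : (∀ x y z → x *′ (y +′ z) ≈′ x *′ y +′ x *′ z) Product.× (∀ x y z → (y +′ z) *′ x ≈′ y *′ x +′ z *′ x)
    *′-distrib-+′ =
        (λ (x₁ , x₂) (y₁ , y₂) (z₁ , z₂) →
            solve 7 (λ x₁ x₂ y₁ y₂ z₁ z₂ c → x₁ :* (y₁ :+ z₁) :+ c :* (x₂ :* (y₂ :+ z₂))
                                        := (x₁ :* y₁ :+ c :* (x₂ :* y₂)) :+ (x₁ :* z₁ :+ c :* (x₂ :* z₂))) refl x₁ x₂ y₁ y₂ z₁ z₂ c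
          , solve 7 (λ x₁ x₂ y₁ y₂ z₁ z₂ s → x₁ :* (y₂ :+ z₂) :+ x₂ :* (y₁ :+ z₁) :+ s :* (x₂ :* (y₂ :+ z₂))
                                        := (x₁ :* y₂ :+ x₂ :* y₁ :+ s :* (x₂ :* y₂)) :+ (x₁ :* z₂ :+ x₂ :* z₁ :+ s :* (x₂ :* z₂))) refl x₁ x₂ y₁ y₂ z₁ z₂ s)
      , (λ (x₁ , x₂) (y₁ , y₂) (z₁ , z₂) →
            solve 7 (λ x₁ x₂ y₁ y₂ z₁ z₂ c → (y₁ :+ z₁) :* x₁ :+ c :* ((y₂ :+ z₂) :* x₂)
                                        := (y₁ :* x₁ :+ c :* (y₂ :* x₂)) :+ (z₁ :* x₁ :+ c :* (z₂ :* x₂))) refl x₁ x₂ y₁ y₂ z₁ z₂ c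
          , solve 7 (λ x₁ x₂ y₁ y₂ z₁ z₂ s → (y₁ :+ z₁) :* x₂ :+ (y₂ :+ z₂) :* x₁ :+ s :* ((y₂ :+ z₂) :* x₂)
                                        := (y₁ :* x₂ :+ y₂ :* x₁ :+ s :* (y₂ :* x₂)) :+ (z₁ :* x₂ :+ z₂ :* x₁ :+ s :* (z₂ :* x₂))) refl x₁ x₂ y₁ y₂ z₁ z₂ s)

    *′-comm : ∀ x y → x *′ y ≈′ y *′ x
    *′-comm (x₁ , x₂) (y₁ , y₂) =
        solve 5 (λ x₁ x₂ y₁ y₂ c → x₁ :* y₁ :+ c :* (x₂ :* y₂) := y₁ :* x₁ :+ c :* (y₂ :* x₂)) refl x₁ x₂ y₁ y₂ c
      , solve 5 (λ x₁ x₂ y₁ y₂ s → x₁ :* y₂ :+ x₂ :* y₁ :+ s :* (x₂ :* y₂) := y₁ :* x₂ :+ y₂ :* x₁ :+ s :* (y₂ :* x₂)) refl x₁ x₂ y₁ y₂ s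

    ι-cong : ∀ {u v} → u ≈ v → ι u ≈′ ι v
    ι-cong u≈v = u≈v , refl

    ι-+ : ∀ u v → ι (u + v) ≈′ ι u +′ ι v
    ι-+ u v = refl , sym (+-identityʳ 0#)

    ι-* : ∀ u v → ι (u * v) ≈′ ι u *′ ι v
    ι-* u v = solve 3 (λ u v c → u :* v := u :* v :+ c :* (con (+ 0) :* con (+ 0))) refl u v c
            , solve 3 (λ u v s → con (+ 0) := u :* con (+ 0) :+ con (+ 0) :* v :+ s :* (con (+ 0) :* con (+ 0))) refl u v s

    ι-neg : ∀ u → ι (- u) ≈′ -′ ι u
    ι-neg u = refl , sym -0#≈0#

    ι-injective : ∀ {u v} → ι u ≈′ ι v → u ≈ v
    ι-injective = proj₁

    t*t̄≈-c : t *′ t̄ ≈′ ι (- c)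
    t*t̄≈-c = solve 2 (λ s c → con (+ 0) :* s :+ c :* (con (+ 1) :* (:- con (+ 1))) := :- c) refl s c
           , solve 2 (λ s c → con (+ 0) :* (:- con (+ 1)) :+ con (+ 1) :* s :+ s :* (con (+ 1) :* (:- con (+ 1))) := con (+ 0)) refl s c

    t+t̄≈s : t +′ t̄ ≈′ ι s
    t+t̄≈s = +-identityˡ s , -‿inverseʳ 1#

  ring′ : CommutativeRing ℓ₁ ℓ₂
  ring′ = record
    { Carrier = Carrier′ ; _≈_ = _≈′_ ; _+_ = _+′_ ; _*_ = _*′_ ; -_ = -′_ ; 0# = ι 0# ; 1# = ι 1#
    ; isCommutativeRing = record
      { isRing = record
        { +-isAbelianGroup = record
          { isGroup = record
            { isMonoid = record
              { isSemigroup = record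
                { isMagma = record { isEquivalence = ≈′-isEquivalence ; ∙-cong = +′-cong }
                ; assoc = +′-assoc }
              ; identity = +′-identity }
            ; inverse = -′-inverse
            ; ⁻¹-cong = -′-cong }
          ; comm = +′-comm }
        ; *-cong = *′-cong
        ; *-assoc = *′-assoc
        ; *-identity = *′-identity
        ; distrib = *′-distrib-+′ }
      ; *-comm = *′-comm }
    }

  ι-isRingMonomorphism : IsRingMonomorphism (CommutativeRing.rawRing R) (CommutativeRing.rawRing ring′) ι
  ι-isRingMonomorphism = record
    { isRingHomomorphism = record
      { isSemiringHomomorphism = record
        { isNearSemiringHomomorphism = record
          { +-isMonoidHomomorphism = record
            { isMagmaHomomorphism = record { isRelHomomorphism = record { cong = ι-cong } ; homo = ι-+ }
            ; ε-homo = IsEquivalence.refl ≈′-isEquivalence }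
          ; *-homo = ι-* }
        ; 1#-homo = IsEquivalence.refl ≈′-isEquivalence }
      ; -‿homo = ι-neg }
    ; injective = ι-injective }

module IntegerPowers {ℓ₁ ℓ₂ : Level} (R : CommutativeRing ℓ₁ ℓ₂) where
  open CommutativeRing R hiding (zero)
  open IntegerCoefficients R using (solve; _:*_; _:=_)
  open Determinant R using (pow≡^)
  open import Algebra.Properties.CommutativeSemiring.Exp commutativeSemiring using (_^_; ^-congˡ; ^-distrib-*)
  open import Relation.Binary.Reasoning.Setoid setoid

  pow-cong : ∀ {x y} n → x ≈ y → pow R x n ≈ pow R y n
  pow-cong {x} {y} n x≈y rewrite pow≡^ x n | pow≡^ y n = ^-congˡ n x≈y

  pow-distrib-* : ∀ x y n → pow R (x * y) n ≈ pow R x n * pow R y n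
  pow-distrib-* x y n rewrite pow≡^ (x * y) n | pow≡^ x n | pow≡^ y n = ^-distrib-* x y n

  zpow-cong : ∀ {x x′ y y′} e → x ≈ x′ → y ≈ y′ → zpow R x y e ≈ zpow R x′ y′ e
  zpow-cong (+ n)    x≈x′ _    = pow-cong n x≈x′
  zpow-cong -[1+ n ] _    y≈y′ = pow-cong (suc n) y≈y′

  zpow-distrib-* : ∀ x x⁻¹ y y⁻¹ e → zpow R (x * y) (x⁻¹ * y⁻¹) e ≈ zpow R x x⁻¹ e * zpow R y y⁻¹ e
  zpow-distrib-* x x⁻¹ y y⁻¹ (+ n)    = pow-distrib-* x y n
  zpow-distrib-* x x⁻¹ y y⁻¹ -[1+ n ] = pow-distrib-* x⁻¹ y⁻¹ (suc n)

  module Unit (x x⁻¹ : Carrier) (x*x⁻¹≈1 : x * x⁻¹ ≈ 1#) where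

    x^ : ℤ → Carrier
    x^ = zpow R x x⁻¹

    *-cancelˡ : ∀ {u v} → x * u ≈ x * v → u ≈ v
    *-cancelˡ {u} {v} xu≈xv = begin
      u                  ≈⟨ *-identityˡ u ⟨
      1# * u             ≈⟨ *-congʳ x*x⁻¹≈1 ⟨
      (x * x⁻¹) * u      ≈⟨ solve 3 (λ x y u → (x :* y) :* u := y :* (x :* u)) refl x x⁻¹ u ⟩
      x⁻¹ * (x * u)      ≈⟨ *-congˡ xu≈xv ⟩
      x⁻¹ * (x * v)      ≈⟨ solve 3 (λ x y v → y :* (x :* v) := (x :* y) :* v) refl x x⁻¹ v ⟩
      (x * x⁻¹) * v      ≈⟨ *-congʳ x*x⁻¹≈1 ⟩
      1# * v             ≈⟨ *-identityˡ v ⟩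
      v                  ∎

    x^-suc : ∀ n → x^ (ℤ.suc n) ≈ x * x^ n
    x^-suc (+ n)            = refl
    x^-suc -[1+ zero ]      = sym (trans (*-congˡ (*-identityʳ _)) x*x⁻¹≈1)
    x^-suc -[1+ suc n ]     = sym (trans (sym (*-assoc _ _ _)) (trans (*-congʳ x*x⁻¹≈1) (*-identityˡ _)))

    x^-+ : ∀ a b → x^ (a ℤ.+ b) ≈ x^ a * x^ b
    x^-+ a = ℤ-induction (λ b → x^ (a ℤ.+ b) ≈ x^ a * x^ b) base up down
      where
      base : x^ (a ℤ.+ + 0) ≈ x^ a * x^ (+ 0)
      base = trans (reflexive (≡.cong x^ (ℤ.+-identityʳ a))) (sym (*-identityʳ _))
      a+[1+b] : ∀ b → a ℤ.+ ℤ.suc b ≡ ℤ.suc (a ℤ.+ b)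
      a+[1+b] b = ≡.trans (≡.sym (ℤ.+-assoc a (+ 1) b)) (≡.trans (≡.cong (λ z → z ℤ.+ b) (ℤ.+-comm a (+ 1))) (ℤ.+-assoc (+ 1) a b))
      shuffle : ∀ b → x * (x^ a * x^ b) ≈ x^ a * (x * x^ b)
      shuffle b = solve 3 (λ x p q → x :* (p :* q) := p :* (x :* q)) refl x (x^ a) (x^ b)
      up : ∀ b → x^ (a ℤ.+ b) ≈ x^ a * x^ b → x^ (a ℤ.+ ℤ.suc b) ≈ x^ a * x^ (ℤ.suc b)
      up b ih = begin
        x^ (a ℤ.+ ℤ.suc b)      ≡⟨ ≡.cong x^ (a+[1+b] b) ⟩
        x^ (ℤ.suc (a ℤ.+ b))    ≈⟨ x^-suc (a ℤ.+ b) ⟩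
        x * x^ (a ℤ.+ b)        ≈⟨ *-congˡ ih ⟩
        x * (x^ a * x^ b)       ≈⟨ shuffle b ⟩
        x^ a * (x * x^ b)       ≈⟨ *-congˡ (x^-suc b) ⟨
        x^ a * x^ (ℤ.suc b)     ∎
      down : ∀ b → x^ (a ℤ.+ ℤ.suc b) ≈ x^ a * x^ (ℤ.suc b) → x^ (a ℤ.+ b) ≈ x^ a * x^ b
      down b ih = *-cancelˡ (begin
        x * x^ (a ℤ.+ b)        ≈⟨ x^-suc (a ℤ.+ b) ⟨
        x^ (ℤ.suc (a ℤ.+ b))    ≡⟨ ≡.cong x^ (a+[1+b] b) ⟨
        x^ (a ℤ.+ ℤ.suc b)      ≈⟨ ih ⟩
        x^ a * x^ (ℤ.suc b)     ≈⟨ *-congˡ (x^-suc b) ⟩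
        x^ a * (x * x^ b)       ≈⟨ shuffle b ⟨
        x * (x^ a * x^ b)       ∎)

    x^-*-+ : ∀ a n → x^ (a ℤ.* + n) ≈ x^ a ^ n
    x^-*-+ a zero    = reflexive (≡.cong x^ (ℤ.*-zeroʳ a))
    x^-*-+ a (suc n) = begin
      x^ (a ℤ.* + suc n)       ≡⟨ ≡.cong x^ (ℤ.*-suc a (+ n)) ⟩
      x^ (a ℤ.+ a ℤ.* + n)     ≈⟨ x^-+ a (a ℤ.* + n) ⟩
      x^ a * x^ (a ℤ.* + n)    ≈⟨ *-congˡ (x^-*-+ a n) ⟩
      x^ a * x^ a ^ n          ∎

module RingHomomorphismProperties
  {a₁ a₂ b₁ b₂ : Level} {R : CommutativeRing a₁ a₂} {S : CommutativeRing b₁ b₂}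
  {h : CommutativeRing.Carrier R → CommutativeRing.Carrier S}
  (isHom : IsRingHomomorphism (CommutativeRing.rawRing R) (CommutativeRing.rawRing S) h) where
  private module R = CommutativeRing R
  open CommutativeRing S hiding (zero)
  open IsRingHomomorphism isHom
  open IntegerPowers S using (pow-cong)

  h-pow : ∀ u k → h (pow R u k) ≈ pow S (h u) k
  h-pow u zero    = 1#-homo
  h-pow u (suc k) = trans (*-homo _ _) (*-congˡ (h-pow u k))

  h-pow-1 : ∀ k → h (pow R (R.- R.1#) k) ≈ pow S (- 1#) k
  h-pow-1 k = trans (h-pow _ k) (pow-cong k (trans (-‿homo _) (-‿cong 1#-homo)))

  h-natR : ∀ k → h (natR R k) ≈ natR S k
  h-natR zero    = 0#-homo
  h-natR (suc k) = trans (+-homo _ _) (+-cong 1#-homo (h-natR k))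

  h-signℤ : ∀ e → h (signℤ R e) ≈ signℤ S e
  h-signℤ e = h-pow-1 ℤ.∣ e ∣

  h-zpow : ∀ u u⁻¹ e → h (zpow R u u⁻¹ e) ≈ zpow S (h u) (h u⁻¹) e
  h-zpow u u⁻¹ (+ n)     = h-pow u n
  h-zpow u u⁻¹ -[1+ n ]  = h-pow u⁻¹ (suc n)

  h-sumF : ∀ n (f : Fin n → R.Carrier) → h (sumF R n f) ≈ sumF S n (h ∘ f)
  h-sumF zero    f = 0#-homo
  h-sumF (suc n) f = trans (+-homo _ _) (+-congˡ (h-sumF n (f ∘ suc)))

  h-prodF : ∀ n (f : Fin n → R.Carrier) → h (prodF R n f) ≈ prodF S n (h ∘ f)
  h-prodF zero    f = 1#-homo
  h-prodF (suc n) f = trans (*-homo _ _) (*-congˡ (h-prodF n (f ∘ suc)))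

  sumF-cong : ∀ n {f g : Fin n → Carrier} → (∀ i → f i ≈ g i) → sumF S n f ≈ sumF S n g
  sumF-cong zero    f≈g = refl
  sumF-cong (suc n) f≈g = +-cong (f≈g zero) (sumF-cong n (f≈g ∘ suc))

  h-det : ∀ n (M : Fin n → Fin n → R.Carrier) → h (det R n M) ≈ det S n (λ i j → h (M i j))
  h-det zero    M = 1#-homo
  h-det (suc n) M = trans (h-sumF (suc n) cofactorTerm) (sumF-cong (suc n) (λ j →
    trans (*-homo _ _) (*-cong (h-pow-1 (toℕ j)) (trans (*-homo (M zero j) _) (*-congˡ (h-det n (λ i′ j′ → M (suc i′) (punchIn j j′))))))))
    where
    cofactorTerm : Fin (suc n) → R.Carrier
    cofactorTerm j = pow R (R.- R.1#) (toℕ j) R.* (M zero j R.* det R n (λ i′ j′ → M (suc i′) (punchIn j j′)))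

module LinearRecurrence {ℓ₁ ℓ₂ : Level} (S : CommutativeRing ℓ₁ ℓ₂)
  (λ₀ λ₀⁻¹ μ₀ μ₀⁻¹ σ π : CommutativeRing.Carrier S)
  (λ₀*λ₀⁻¹≈1 : CommutativeRing._≈_ S (CommutativeRing._*_ S λ₀ λ₀⁻¹) (CommutativeRing.1# S))
  (μ₀*μ₀⁻¹≈1 : CommutativeRing._≈_ S (CommutativeRing._*_ S μ₀ μ₀⁻¹) (CommutativeRing.1# S))
  (λ₀+μ₀≈σ : CommutativeRing._≈_ S (CommutativeRing._+_ S λ₀ μ₀) σ)
  (λ₀*μ₀≈-π : CommutativeRing._≈_ S (CommutativeRing._*_ S λ₀ μ₀) (CommutativeRing.-_ S π)) where
  open CommutativeRing S
  open IntegerCoefficients S using (solve; _:+_; _:*_; _:-_; :-_; _:=_; con)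
  open Algebra.Properties.Ring ring using (-‿involutive; -0#≈0#; +-cancelʳ)
  open import Relation.Binary.Reasoning.Setoid setoid
  module Λ = IntegerPowers.Unit S λ₀ λ₀⁻¹ λ₀*λ₀⁻¹≈1
  module Μ = IntegerPowers.Unit S μ₀ μ₀⁻¹ μ₀*μ₀⁻¹≈1
  open Λ using () renaming (x^ to λ^)
  open Μ using () renaming (x^ to μ^)

  Recurrent : (ℤ → Carrier) → Set ℓ₂
  Recurrent u = ∀ n → u (ℤ.suc (ℤ.suc n)) ≈ σ * u (ℤ.suc n) + π * u n

  gap : (ℤ → Carrier) → Carrier
  gap u = u (+ 1) - μ₀ * u (+ 0)

  gap-geometric : ∀ u → Recurrent u → ∀ n → u (ℤ.suc n) ≈ μ₀ * u n + λ^ n * gap u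
  gap-geometric u rec = ℤ-induction (λ n → u (ℤ.suc n) ≈ μ₀ * u n + λ^ n * gap u) base up down
    where
    rec′ : ∀ n → u (ℤ.suc (ℤ.suc n)) ≈ μ₀ * u (ℤ.suc n) + λ₀ * (u (ℤ.suc n) - μ₀ * u n)
    rec′ n = begin
      u (ℤ.suc (ℤ.suc n))                                   ≈⟨ rec n ⟩
      σ * u (ℤ.suc n) + π * u n                             ≈⟨ +-cong (*-congʳ λ₀+μ₀≈σ) (*-congʳ (trans (-‿cong λ₀*μ₀≈-π) (-‿involutive π))) ⟨
      (λ₀ + μ₀) * u (ℤ.suc n) + - (λ₀ * μ₀) * u n
        ≈⟨ solve 4 (λ l m a b → (l :+ m) :* a :+ (:- (l :* m)) :* b := m :* a :+ l :* (a :- m :* b)) refl λ₀ μ₀ _ _ ⟩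
      μ₀ * u (ℤ.suc n) + λ₀ * (u (ℤ.suc n) - μ₀ * u n)      ∎
    base : u (+ 1) ≈ μ₀ * u (+ 0) + 1# * gap u
    base = solve 3 (λ a b m → a := m :* b :+ con (+ 1) :* (a :- m :* b)) refl (u (+ 1)) (u (+ 0)) μ₀
    up : ∀ n → u (ℤ.suc n) ≈ μ₀ * u n + λ^ n * gap u → u (ℤ.suc (ℤ.suc n)) ≈ μ₀ * u (ℤ.suc n) + λ^ (ℤ.suc n) * gap u
    up n ih = begin
      u (ℤ.suc (ℤ.suc n))                                   ≈⟨ rec′ n ⟩
      μ₀ * u (ℤ.suc n) + λ₀ * (u (ℤ.suc n) - μ₀ * u n)
        ≈⟨ +-congˡ (*-congˡ (trans (+-congʳ ih) (solve 2 (λ a b → (a :+ b) :- a := b) refl _ _))) ⟩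
      μ₀ * u (ℤ.suc n) + λ₀ * (λ^ n * gap u)                ≈⟨ +-congˡ (trans (sym (*-assoc _ _ _)) (*-congʳ (sym (Λ.x^-suc n)))) ⟩
      μ₀ * u (ℤ.suc n) + λ^ (ℤ.suc n) * gap u               ∎
    down : ∀ n → u (ℤ.suc (ℤ.suc n)) ≈ μ₀ * u (ℤ.suc n) + λ^ (ℤ.suc n) * gap u → u (ℤ.suc n) ≈ μ₀ * u n + λ^ n * gap u
    down n ih = begin
      u (ℤ.suc n)                                 ≈⟨ solve 3 (λ a m b → a := m :* b :+ (a :- m :* b)) refl _ μ₀ _ ⟩
      μ₀ * u n + (u (ℤ.suc n) - μ₀ * u n)         ≈⟨ +-congˡ (Λ.*-cancelˡ λ₀*gap) ⟩
      μ₀ * u n + λ^ n * gap u                     ∎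
      where
      λ₀*gap : λ₀ * (u (ℤ.suc n) - μ₀ * u n) ≈ λ₀ * (λ^ n * gap u)
      λ₀*gap = begin
        λ₀ * (u (ℤ.suc n) - μ₀ * u n)                                        ≈⟨ solve 2 (λ x y → x := (y :+ x) :- y) refl _ (μ₀ * u (ℤ.suc n)) ⟩
        (μ₀ * u (ℤ.suc n) + λ₀ * (u (ℤ.suc n) - μ₀ * u n)) - μ₀ * u (ℤ.suc n) ≈⟨ +-congʳ (trans (sym (rec′ n)) ih) ⟩
        (μ₀ * u (ℤ.suc n) + λ^ (ℤ.suc n) * gap u) - μ₀ * u (ℤ.suc n)           ≈⟨ solve 2 (λ x y → (y :+ x) :- y := x) refl _ _ ⟩
        λ^ (ℤ.suc n) * gap u                                                  ≈⟨ *-congʳ (Λ.x^-suc n) ⟩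
        (λ₀ * λ^ n) * gap u                                                   ≈⟨ *-assoc _ _ _ ⟩
        λ₀ * (λ^ n * gap u)                                                   ∎

  module _ (U : ℤ → Carrier) (rec-U : Recurrent U) (U₀≈0 : U (+ 0) ≈ 0#) (U₁≈1 : U (+ 1) ≈ 1#) where

    gap-U : gap U ≈ 1#
    gap-U = trans (+-cong U₁≈1 (-‿cong (trans (*-congˡ U₀≈0) (zeroʳ _)))) (trans (+-congˡ -0#≈0#) (+-identityʳ _))

    U-step : ∀ n → U (ℤ.suc n) ≈ μ₀ * U n + λ^ n
    U-step n = trans (gap-geometric U rec-U n) (+-congˡ (trans (*-congˡ gap-U) (*-identityʳ _)))

    addition : ∀ u → Recurrent u → ∀ a b → u (a ℤ.+ b) ≈ μ^ a * u b + U a * (gap u * λ^ b)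
    addition u rec-u a b = ℤ-induction (λ a → u (a ℤ.+ b) ≈ μ^ a * u b + U a * (gap u * λ^ b)) base up down a
      where
      [1+a]+b : ∀ a → ℤ.suc a ℤ.+ b ≡ ℤ.suc (a ℤ.+ b)
      [1+a]+b a = ℤ.+-assoc (+ 1) a b
      rearrange : ∀ a → μ₀ * (μ^ a * u b + U a * (gap u * λ^ b)) + (λ^ a * λ^ b) * gap u ≈
                        (μ₀ * μ^ a) * u b + (μ₀ * U a + λ^ a) * (gap u * λ^ b)
      rearrange a = solve 7 (λ m za ub Ua g zb la → m :* (za :* ub :+ Ua :* (g :* zb)) :+ (la :* zb) :* g
                                                   := (m :* za) :* ub :+ (m :* Ua :+ la) :* (g :* zb)) refl _ _ _ _ _ _ _
      base : u (+ 0 ℤ.+ b) ≈ 1# * u b + U (+ 0) * (gap u * λ^ b)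
      base = trans (reflexive (≡.cong u (ℤ.+-identityˡ b)))
                   (sym (trans (+-cong (*-identityˡ _) (trans (*-congʳ U₀≈0) (zeroˡ _))) (+-identityʳ _)))
      up : ∀ a → u (a ℤ.+ b) ≈ μ^ a * u b + U a * (gap u * λ^ b) →
           u (ℤ.suc a ℤ.+ b) ≈ μ^ (ℤ.suc a) * u b + U (ℤ.suc a) * (gap u * λ^ b)
      up a ih = begin
        u (ℤ.suc a ℤ.+ b)                                        ≡⟨ ≡.cong u ([1+a]+b a) ⟩
        u (ℤ.suc (a ℤ.+ b))                                      ≈⟨ gap-geometric u rec-u (a ℤ.+ b) ⟩
        μ₀ * u (a ℤ.+ b) + λ^ (a ℤ.+ b) * gap u                  ≈⟨ +-cong (*-congˡ ih) (*-congʳ (Λ.x^-+ a b)) ⟩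
        μ₀ * (μ^ a * u b + U a * (gap u * λ^ b)) + (λ^ a * λ^ b) * gap u ≈⟨ rearrange a ⟩
        (μ₀ * μ^ a) * u b + (μ₀ * U a + λ^ a) * (gap u * λ^ b)   ≈⟨ +-cong (*-congʳ (Μ.x^-suc a)) (*-congʳ (U-step a)) ⟨
        μ^ (ℤ.suc a) * u b + U (ℤ.suc a) * (gap u * λ^ b)        ∎
      down : ∀ a → u (ℤ.suc a ℤ.+ b) ≈ μ^ (ℤ.suc a) * u b + U (ℤ.suc a) * (gap u * λ^ b) →
             u (a ℤ.+ b) ≈ μ^ a * u b + U a * (gap u * λ^ b)
      down a ih = Μ.*-cancelˡ (+-cancelʳ (λ^ (a ℤ.+ b) * gap u) _ _ (begin
        μ₀ * u (a ℤ.+ b) + λ^ (a ℤ.+ b) * gap u                  ≈⟨ gap-geometric u rec-u (a ℤ.+ b) ⟨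
        u (ℤ.suc (a ℤ.+ b))                                      ≡⟨ ≡.cong u ([1+a]+b a) ⟨
        u (ℤ.suc a ℤ.+ b)                                        ≈⟨ ih ⟩
        μ^ (ℤ.suc a) * u b + U (ℤ.suc a) * (gap u * λ^ b)        ≈⟨ +-cong (*-congʳ (Μ.x^-suc a)) (*-congʳ (U-step a)) ⟩
        (μ₀ * μ^ a) * u b + (μ₀ * U a + λ^ a) * (gap u * λ^ b)   ≈⟨ rearrange a ⟨
        μ₀ * (μ^ a * u b + U a * (gap u * λ^ b)) + (λ^ a * λ^ b) * gap u ≈⟨ +-congˡ (*-congʳ (Λ.x^-+ a b)) ⟨
        μ₀ * (μ^ a * u b + U a * (gap u * λ^ b)) + λ^ (a ℤ.+ b) * gap u ∎))

module HankelDeterminantOfP {ℓ₁ ℓ₂ : Level} (R : CommutativeRing ℓ₁ ℓ₂)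
  (p q r a b c c⁻¹ x : CommutativeRing.Carrier R)
  (c*c⁻¹≈1 : CommutativeRing._≈_ R (CommutativeRing._*_ R c c⁻¹) (CommutativeRing.1# R)) where
  private
    module R = CommutativeRing R
    module ℤR = IntegerCoefficients R

  σ : R.Carrier
  σ = a R.* x R.+ b

  backwards : ∀ y z → y R.≈ σ R.* z R.+ c R.* (c⁻¹ R.* (y R.- σ R.* z))
  backwards y z = begin
    y                                         ≈⟨ ℤR.solve 3 (λ y s z → y ℤR.:= s ℤR.:* z ℤR.:+ (y ℤR.:- s ℤR.:* z)) R.refl y σ z ⟩
    σ R.* z R.+ (y R.- σ R.* z)               ≈⟨ R.+-congˡ (R.trans (R.*-congʳ c*c⁻¹≈1) (R.*-identityˡ _)) ⟨
    σ R.* z R.+ c R.* c⁻¹ R.* (y R.- σ R.* z) ≈⟨ R.+-congˡ (R.*-assoc _ _ _) ⟩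
    σ R.* z R.+ c R.* (c⁻¹ R.* (y R.- σ R.* z)) ∎
    where open import Relation.Binary.Reasoning.Setoid R.setoid

  seqP-recurrent : ∀ p′ q′ r′ n → seqP R p′ q′ r′ a b c c⁻¹ x (ℤ.suc (ℤ.suc n)) R.≈
                     σ R.* seqP R p′ q′ r′ a b c c⁻¹ x (ℤ.suc n) R.+ c R.* seqP R p′ q′ r′ a b c c⁻¹ x n
  seqP-recurrent p′ q′ r′ (+ n)              = R.refl
  seqP-recurrent p′ q′ r′ -[1+ zero ]        = backwards _ _
  seqP-recurrent p′ q′ r′ -[1+ suc zero ]    = backwards _ _
  seqP-recurrent p′ q′ r′ -[1+ suc (suc n) ] = backwards _ _

  P0 P1 : R.Carrier
  P0 = p
  P1 = q R.* x R.+ r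

  discriminant : P1 R.* P1 R.- σ R.* (P1 R.* P0) R.+ (R.- c) R.* (P0 R.* P0) R.≈ ΔP R p q r a b c x
  discriminant = solve 7 (λ p q r a b c x →
      (q :* x :+ r) :* (q :* x :+ r) :- (a :* x :+ b) :* ((q :* x :+ r) :* p) :+ (:- c) :* (p :* p)
    := (q :* q :- a :* p :* q) :* (x :* x) :+ ((con (+ 1) :+ (con (+ 1) :+ con (+ 0))) :* q :* r :- a :* p :* r :- b :* p :* q) :* x
         :+ (r :* r :- b :* p :* r :- c :* (p :* p))) R.refl p q r a b c x
    where open ℤR using (solve; _:+_; _:*_; _:-_; :-_; _:=_; con)

  open QuadraticExtension R σ c
  open CommutativeRing ring′ hiding (zero)
  open IntegerCoefficients ring′ using (solve; _:+_; _:*_; _:-_; :-_; _:=_; con)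
  open import Relation.Binary.Reasoning.Setoid setoid

  -c -c⁻¹ t⁻¹ t̄⁻¹ : Carrier′
  -c   = ι (R.- c)
  -c⁻¹ = ι (R.- c⁻¹)
  t⁻¹  = t̄ * -c⁻¹
  t̄⁻¹  = t * -c⁻¹

  -c*-c⁻¹≈1 : -c * -c⁻¹ ≈ 1#
  -c*-c⁻¹≈1 = trans (sym (ι-* _ _)) (ι-cong (R.trans (ℤR.solve 2 (λ c d → (ℤR.:- c) ℤR.:* (ℤR.:- d) ℤR.:= c ℤR.:* d) R.refl c c⁻¹) c*c⁻¹≈1))

  t*t⁻¹≈1 : t * t⁻¹ ≈ 1#
  t*t⁻¹≈1 = trans (sym (*-assoc _ _ _)) (trans (*-congʳ t*t̄≈-c) -c*-c⁻¹≈1)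

  t̄*t̄⁻¹≈1 : t̄ * t̄⁻¹ ≈ 1#
  t̄*t̄⁻¹≈1 = trans (sym (*-assoc _ _ _)) (trans (*-congʳ (trans (*-comm t̄ t) t*t̄≈-c)) -c*-c⁻¹≈1)

  t⁻¹*t̄⁻¹≈-c⁻¹ : t⁻¹ * t̄⁻¹ ≈ -c⁻¹
  t⁻¹*t̄⁻¹≈-c⁻¹ = begin
    (t̄ * -c⁻¹) * (t * -c⁻¹)      ≈⟨ solve 3 (λ m l d → (m :* d) :* (l :* d) := (l :* m) :* (d :* d)) refl t̄ t -c⁻¹ ⟩
    (t * t̄) * (-c⁻¹ * -c⁻¹)      ≈⟨ *-congʳ t*t̄≈-c ⟩
    -c * (-c⁻¹ * -c⁻¹)           ≈⟨ *-assoc _ _ _ ⟨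
    (-c * -c⁻¹) * -c⁻¹           ≈⟨ *-congʳ -c*-c⁻¹≈1 ⟩
    1# * -c⁻¹                    ≈⟨ *-identityˡ _ ⟩
    -c⁻¹                         ∎

  P′ U′ : ℤ → Carrier′
  P′ = ι ∘ seqP R p q r a b c c⁻¹ x
  U′ = ι ∘ seqP R R.0# R.0# R.1# a b c c⁻¹ x

  module Lt = LinearRecurrence ring′ t t⁻¹ t̄ t̄⁻¹ (ι σ) (ι c) t*t⁻¹≈1 t̄*t̄⁻¹≈1 t+t̄≈s (trans t*t̄≈-c (ι-neg c))
  module Lt̄ = LinearRecurrence ring′ t̄ t̄⁻¹ t t⁻¹ (ι σ) (ι c) t̄*t̄⁻¹≈1 t*t⁻¹≈1
                (trans (+-comm t̄ t) t+t̄≈s) (trans (*-comm t̄ t) (trans t*t̄≈-c (ι-neg c)))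

  ι-recurrent : ∀ p′ q′ r′ → Lt.Recurrent (ι ∘ seqP R p′ q′ r′ a b c c⁻¹ x)
  ι-recurrent p′ q′ r′ n = trans (ι-cong (seqP-recurrent p′ q′ r′ n)) (trans (ι-+ _ _) (+-cong (ι-* _ _) (ι-* _ _)))

  U′₀≈0 : U′ (+ 0) ≈ 0#
  U′₀≈0 = refl

  U′₁≈1 : U′ (+ 1) ≈ 1#
  U′₁≈1 = ι-cong (R.trans (R.+-congʳ (R.zeroˡ x)) (R.+-identityˡ R.1#))

  gap-product : Lt.gap P′ * Lt̄.gap P′ ≈ ι (ΔP R p q r a b c x)
  gap-product = begin
    (P′ (+ 1) - t̄ * P′ (+ 0)) * (P′ (+ 1) - t * P′ (+ 0))
      ≈⟨ solve 4 (λ u v l m → (u :- m :* v) :* (u :- l :* v) := u :* u :- (l :+ m) :* (u :* v) :+ (l :* m) :* (v :* v)) refl (P′ (+ 1)) (P′ (+ 0)) t t̄ ⟩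
    P′ (+ 1) * P′ (+ 1) - (t + t̄) * (P′ (+ 1) * P′ (+ 0)) + (t * t̄) * (P′ (+ 0) * P′ (+ 0))
      ≈⟨ +-cong (+-congˡ (-‿cong (*-congʳ t+t̄≈s))) (*-congʳ t*t̄≈-c) ⟩
    ι P1 * ι P1 - ι σ * (ι P1 * ι P0) + -c * (ι P0 * ι P0)
      ≈⟨ +-cong (+-cong (ι-* _ _) (trans (ι-neg _) (-‿cong (trans (ι-* _ _) (*-congˡ (ι-* _ _)))))) (trans (ι-* _ _) (*-congˡ (ι-* _ _))) ⟨
    ι (P1 R.* P1) + ι (R.- (σ R.* (P1 R.* P0))) + ι ((R.- c) R.* (P0 R.* P0))
      ≈⟨ trans (ι-+ _ _) (+-congʳ (ι-+ _ _)) ⟨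
    ι (P1 R.* P1 R.- σ R.* (P1 R.* P0) R.+ (R.- c) R.* (P0 R.* P0)) ≈⟨ ι-cong discriminant ⟩
    ι (ΔP R p q r a b c x) ∎

  open import Algebra.Properties.CommutativeSemiring.Exp commutativeSemiring using (_^_; ^-congˡ; ^-distrib-*; ^-assocʳ)
  module T = IntegerPowers.Unit ring′ t t⁻¹ t*t⁻¹≈1
  module T̄ = IntegerPowers.Unit ring′ t̄ t̄⁻¹ t̄*t̄⁻¹≈1
  open T using () renaming (x^ to t^)
  open T̄ using () renaming (x^ to t̄^)

  module Instance (t₀ k : ℤ) where
    open +-*-Solver using () renaming (solve to ℤ-solve; _:+_ to _⊕_; _:*_ to _⊗_; _:=_ to _⊜_; con to ℤ-con)

    A f : ℕ → Carrier′
    A i = U′ (k ℤ.* + i)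
    f i = P′ (t₀ ℤ.+ k ℤ.* + i)

    α β : Carrier′
    α = Lt̄.gap P′ * t̄^ t₀
    β = Lt.gap P′ * t^ t₀

    additionU : ∀ a b → U′ (a ℤ.+ b) ≈ t̄^ a * U′ b + U′ a * t^ b
    additionU a b = trans (Lt.addition U′ (ι-recurrent R.0# R.0# R.1#) U′₀≈0 U′₁≈1 U′ (ι-recurrent R.0# R.0# R.1#) a b)
                          (+-congˡ (*-congˡ (trans (*-congʳ (Lt.gap-U U′ (ι-recurrent R.0# R.0# R.1#) U′₀≈0 U′₁≈1)) (*-identityˡ _))))

    additionP : ∀ a b → P′ (a ℤ.+ b) ≈ t̄^ a * P′ b + U′ a * (Lt.gap P′ * t^ b)
    additionP = Lt.addition U′ (ι-recurrent R.0# R.0# R.1#) U′₀≈0 U′₁≈1 P′ (ι-recurrent p q r)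

    A-step-lower : ∀ i → A (suc i) ≈ U′ k * t̄^ k ^ i + t^ k * A i
    A-step-lower i = begin
      U′ (k ℤ.* + suc i)                       ≡⟨ ≡.cong U′ (ℤ-solve 2 (λ k i → k ⊗ (ℤ-con (+ 1) ⊕ i) ⊜ k ⊗ i ⊕ k) ≡.refl k (+ i)) ⟩
      U′ (k ℤ.* + i ℤ.+ k)                     ≈⟨ additionU (k ℤ.* + i) k ⟩
      t̄^ (k ℤ.* + i) * U′ k + A i * t^ k       ≈⟨ +-congʳ (*-congʳ (T̄.x^-*-+ k i)) ⟩
      t̄^ k ^ i * U′ k + A i * t^ k             ≈⟨ +-cong (*-comm _ _) (*-comm _ _) ⟩
      U′ k * t̄^ k ^ i + t^ k * A i             ∎

    A-step-upper : ∀ j → A (suc j) ≈ t̄^ k * A j + U′ k * t^ k ^ j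
    A-step-upper j = begin
      U′ (k ℤ.* + suc j)                       ≡⟨ ≡.cong U′ (ℤ-solve 2 (λ k j → k ⊗ (ℤ-con (+ 1) ⊕ j) ⊜ k ⊕ k ⊗ j) ≡.refl k (+ j)) ⟩
      U′ (k ℤ.+ k ℤ.* + j)                     ≈⟨ additionU k (k ℤ.* + j) ⟩
      t̄^ k * A j + U′ k * t^ (k ℤ.* + j)       ≈⟨ +-congˡ (*-congˡ (T.x^-*-+ k j)) ⟩
      t̄^ k * A j + U′ k * t^ k ^ j             ∎

    f-shift : ∀ i j → f (i ℕ.+ j) ≈ t̄^ k ^ i * f j + A i * (β * t^ k ^ j)
    f-shift i j = begin
      P′ (t₀ ℤ.+ k ℤ.* + (i ℕ.+ j))            ≡⟨ ≡.cong P′ (≡.trans (≡.cong (λ z → t₀ ℤ.+ k ℤ.* z) (ℤ.pos-+ i j))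
                                                           (ℤ-solve 4 (λ t k i j → t ⊕ k ⊗ (i ⊕ j) ⊜ k ⊗ i ⊕ (t ⊕ k ⊗ j)) ≡.refl t₀ k (+ i) (+ j))) ⟩
      P′ (k ℤ.* + i ℤ.+ (t₀ ℤ.+ k ℤ.* + j))    ≈⟨ additionP (k ℤ.* + i) (t₀ ℤ.+ k ℤ.* + j) ⟩
      t̄^ (k ℤ.* + i) * f j + A i * (Lt.gap P′ * t^ (t₀ ℤ.+ k ℤ.* + j))
        ≈⟨ +-cong (*-congʳ (T̄.x^-*-+ k i)) (*-congˡ (*-congˡ (trans (T.x^-+ t₀ (k ℤ.* + j)) (*-congˡ (T.x^-*-+ k j))))) ⟩
      t̄^ k ^ i * f j + A i * (Lt.gap P′ * (t^ t₀ * t^ k ^ j)) ≈⟨ +-congˡ (*-congˡ (sym (*-assoc _ _ _))) ⟩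
      t̄^ k ^ i * f j + A i * (β * t^ k ^ j)    ∎

    f-split : ∀ j → f j ≈ α * A j + P′ t₀ * t^ k ^ j
    f-split j = begin
      P′ (t₀ ℤ.+ k ℤ.* + j)                                ≡⟨ ≡.cong P′ (ℤ.+-comm t₀ (k ℤ.* + j)) ⟩
      P′ (k ℤ.* + j ℤ.+ t₀)
        ≈⟨ Lt̄.addition U′ (ι-recurrent R.0# R.0# R.1#) U′₀≈0 U′₁≈1 P′ (ι-recurrent p q r) (k ℤ.* + j) t₀ ⟩
      t^ (k ℤ.* + j) * P′ t₀ + A j * α                     ≈⟨ +-cong (*-congʳ (T.x^-*-+ k j)) refl ⟩
      t^ k ^ j * P′ t₀ + A j * α                           ≈⟨ trans (+-comm _ _) (+-cong (*-comm _ _) (*-comm _ _)) ⟩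
      α * A j + P′ t₀ * t^ k ^ j                           ∎

    open MonomialMatrices.HankelOfPowers ring′ (t^ k) (t̄^ k) (U′ k) α β (P′ t₀) A f
      (trans (reflexive (≡.cong U′ (ℤ.*-zeroʳ k))) U′₀≈0) A-step-lower A-step-upper f-shift f-split public
      using (det-hankel)

  open Determinant ring′ using (pow≡^; prodF≡product; natR≡×1#; det-cong)
  open IntegerPowers ring′ using (zpow-cong; zpow-distrib-*)
  open Algebra.Properties.Ring ring using (-1*x≈-x)
  open RingHomomorphismProperties {R = R} {S = ring′} {h = ι} (IsRingMonomorphism.isRingHomomorphism ι-isRingMonomorphism)

  ιc*ιc⁻¹≈1 : ι c * ι c⁻¹ ≈ 1#
  ιc*ιc⁻¹≈1 = trans (sym (ι-* c c⁻¹)) (ι-cong c*c⁻¹≈1)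

  -1*-1≈1 : - 1# * - 1# ≈ 1#
  -1*-1≈1 = solve 0 (:- con (+ 1) :* :- con (+ 1) := con (+ 1)) refl

  module C = IntegerPowers.Unit ring′ (ι c) (ι c⁻¹) ιc*ιc⁻¹≈1
  module ±1 = IntegerPowers.Unit ring′ (- 1#) (- 1#) -1*-1≈1
  open C using () renaming (x^ to c^)
  open ±1 using () renaming (x^ to ±1^)

  t^*t̄^ : ∀ e → t^ e * t̄^ e ≈ ±1^ e * c^ e
  t^*t̄^ e = begin
    t^ e * t̄^ e                                  ≈⟨ zpow-distrib-* t t⁻¹ t̄ t̄⁻¹ e ⟨
    zpow ring′ (t * t̄) (t⁻¹ * t̄⁻¹) e             ≈⟨ zpow-cong e (trans t*t̄≈-c (ι-neg c)) (trans t⁻¹*t̄⁻¹≈-c⁻¹ (ι-neg c⁻¹)) ⟩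
    zpow ring′ (- ι c) (- ι c⁻¹) e               ≈⟨ zpow-cong e (sym (-1*x≈-x (ι c))) (sym (-1*x≈-x (ι c⁻¹))) ⟩
    zpow ring′ (- 1# * ι c) (- 1# * ι c⁻¹) e     ≈⟨ zpow-distrib-* (- 1#) (- 1#) (ι c) (ι c⁻¹) e ⟩
    ±1^ e * c^ e                                 ∎

  ±1^-square : ∀ e → ±1^ e * ±1^ e ≈ 1#
  ±1^-square e = begin
    ±1^ e * ±1^ e                  ≈⟨ zpow-distrib-* (- 1#) (- 1#) (- 1#) (- 1#) e ⟨
    zpow ring′ (- 1# * - 1#) (- 1# * - 1#) e ≈⟨ zpow-cong e -1*-1≈1 -1*-1≈1 ⟩
    zpow ring′ 1# 1# e             ≈⟨ zpow-1# e ⟩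
    1#                             ∎
    where
    zpow-1# : ∀ e → zpow ring′ 1# 1# e ≈ 1#
    zpow-1# (+ n)    = trans (reflexive (pow≡^ 1# n)) (MonomialMatrices.1#^n≈1# ring′ n)
    zpow-1# -[1+ n ] = trans (reflexive (pow≡^ 1# (suc n))) (MonomialMatrices.1#^n≈1# ring′ (suc n))

  signℤ≈±1^ : ∀ e → signℤ ring′ e ≈ ±1^ e
  signℤ≈±1^ (+ n)    = refl
  signℤ≈±1^ -[1+ n ] = refl

  module Conclusion (s k n : ℤ) (m : ℕ) where
    open +-*-Solver using () renaming (solve to ℤ-solve; _:+_ to _⊕_; _:*_ to _⊗_; _:=_ to _⊜_; con to ℤ-con)
    open MonomialMatrices ring′ using (∏ℕ; ∏ℕ-cong)
    open import Algebra.Definitions.RawSemiring (Semiring.rawSemiring semiring) using (_×_)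

    t₀ : ℤ
    t₀ = s ℤ.+ k ℤ.* n
    open Instance t₀ k public

    C₂ C₃ : ℕ
    C₂ = suc m C 2
    C₃ = suc m C 3

    e₁ e₂ : ℤ
    e₁ = (s ℤ.+ k ℤ.* n ℤ.+ + 1) ℤ.* + C₂
    e₂ = (s ℤ.+ k ℤ.* n) ℤ.* + C₂ ℤ.+ + 2 ℤ.* k ℤ.* + C₃

    entry : Fin (suc m) → Fin (suc m) → R.Carrier
    entry i j = pow R (seqP R p q r a b c c⁻¹ x (s ℤ.+ k ℤ.* (n ℤ.+ + toℕ i ℤ.+ + toℕ j))) m

    lhs rhs : R.Carrier
    lhs = det R (suc m) entry
    rhs = signℤ R e₁
          R.* (pow R (ΔP R p q r a b c x) C₂
          R.* (zpow R c c⁻¹ e₂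
          R.* prodF R (suc m) (λ i → natR R (m C toℕ i) R.* pow R (seqP R R.0# R.0# R.1# a b c c⁻¹ x (k ℤ.* (+ toℕ i ℤ.+ + 1))) (2 ℕ.* (m ∸ toℕ i)))))

    Π : Carrier′
    Π = ∏ℕ (suc m) (λ i → (m C i) × 1# * A (suc i) ^ (2 ℕ.* (m ∸ i)))

    ι-lhs : ι lhs ≈ det ring′ (suc m) (λ i j → f (toℕ i ℕ.+ toℕ j) ^ m)
    ι-lhs = trans (h-det (suc m) entry) (det-cong (suc m) (λ i j →
      trans (h-pow _ m) (reflexive (≡.trans (pow≡^ _ m) (≡.cong (λ e → P′ e ^ m) (index (toℕ i) (toℕ j)))))))
      where
      index : ∀ i j → s ℤ.+ k ℤ.* (n ℤ.+ + i ℤ.+ + j) ≡ t₀ ℤ.+ k ℤ.* + (i ℕ.+ j)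
      index i j = ≡.trans (ℤ-solve 5 (λ s k n i j → s ⊕ k ⊗ (n ⊕ i ⊕ j) ⊜ (s ⊕ k ⊗ n) ⊕ k ⊗ (i ⊕ j)) ≡.refl s k n (+ i) (+ j))
                          (≡.cong (λ z → t₀ ℤ.+ k ℤ.* z) (≡.sym (ℤ.pos-+ i j)))

    α*β : α * β ≈ ι (ΔP R p q r a b c x) * (±1^ t₀ * c^ t₀)
    α*β = begin
      (Lt̄.gap P′ * t̄^ t₀) * (Lt.gap P′ * t^ t₀)  ≈⟨ solve 4 (λ a b c d → (a :* b) :* (c :* d) := (c :* a) :* (d :* b)) refl _ _ _ _ ⟩
      (Lt.gap P′ * Lt̄.gap P′) * (t^ t₀ * t̄^ t₀)  ≈⟨ *-cong gap-product (t^*t̄^ t₀) ⟩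
      ι (ΔP R p q r a b c x) * (±1^ t₀ * c^ t₀)  ∎

    sign-exponent : signℤ ring′ e₁ ≈ ±1^ t₀ ^ C₂ * (- 1#) ^ C₂
    sign-exponent = begin
      signℤ ring′ e₁                        ≈⟨ signℤ≈±1^ e₁ ⟩
      ±1^ ((t₀ ℤ.+ + 1) ℤ.* + C₂)           ≡⟨ ≡.cong ±1^ (ℤ-solve 2 (λ t c → (t ⊕ ℤ-con (+ 1)) ⊗ c ⊜ t ⊗ c ⊕ c) ≡.refl t₀ (+ C₂)) ⟩
      ±1^ (t₀ ℤ.* + C₂ ℤ.+ + C₂)            ≈⟨ ±1.x^-+ (t₀ ℤ.* + C₂) (+ C₂) ⟩
      ±1^ (t₀ ℤ.* + C₂) * ±1^ (+ C₂)        ≈⟨ *-cong (±1.x^-*-+ t₀ C₂) (reflexive (pow≡^ (- 1#) C₂)) ⟩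
      ±1^ t₀ ^ C₂ * (- 1#) ^ C₂             ∎

    c-exponent : c^ e₂ ≈ c^ t₀ ^ C₂ * c^ k ^ (2 ℕ.* C₃)
    c-exponent = begin
      c^ (t₀ ℤ.* + C₂ ℤ.+ + 2 ℤ.* k ℤ.* + C₃)
        ≡⟨ ≡.cong c^ (≡.trans (ℤ-solve 3 (λ t k c → t ⊗ ℤ-con (+ C₂) ⊕ ℤ-con (+ 2) ⊗ k ⊗ c ⊜ t ⊗ ℤ-con (+ C₂) ⊕ k ⊗ (ℤ-con (+ 2) ⊗ c))
                                          ≡.refl t₀ k (+ C₃))
                              (≡.cong (λ z → t₀ ℤ.* + C₂ ℤ.+ k ℤ.* z) (≡.sym (ℤ.pos-* 2 C₃)))) ⟩
      c^ (t₀ ℤ.* + C₂ ℤ.+ k ℤ.* + (2 ℕ.* C₃))     ≈⟨ C.x^-+ (t₀ ℤ.* + C₂) (k ℤ.* + (2 ℕ.* C₃)) ⟩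
      c^ (t₀ ℤ.* + C₂) * c^ (k ℤ.* + (2 ℕ.* C₃))  ≈⟨ *-cong (C.x^-*-+ t₀ C₂) (C.x^-*-+ k (2 ℕ.* C₃)) ⟩
      c^ t₀ ^ C₂ * c^ k ^ (2 ℕ.* C₃)              ∎

    ι-product : ι (prodF R (suc m) (λ i → natR R (m C toℕ i) R.* pow R (seqP R R.0# R.0# R.1# a b c c⁻¹ x (k ℤ.* (+ toℕ i ℤ.+ + 1))) (2 ℕ.* (m ∸ toℕ i)))) ≈ Π
    ι-product = trans (h-prodF (suc m) g) (trans (reflexive (prodF≡product (suc m) (ι ∘ g))) (∏ℕ-cong (suc m) (λ i _ → factor i)))
      where
      g : Fin (suc m) → R.Carrier
      g i = natR R (m C toℕ i) R.* pow R (seqP R R.0# R.0# R.1# a b c c⁻¹ x (k ℤ.* (+ toℕ i ℤ.+ + 1))) (2 ℕ.* (m ∸ toℕ i))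
      factor : ∀ i → ι (natR R (m C i) R.* pow R (seqP R R.0# R.0# R.1# a b c c⁻¹ x (k ℤ.* (+ i ℤ.+ + 1))) (2 ℕ.* (m ∸ i))) ≈
                     (m C i) × 1# * A (suc i) ^ (2 ℕ.* (m ∸ i))
      factor i = trans (ι-* _ _) (*-cong (trans (h-natR (m C i)) (reflexive (natR≡×1# (m C i))))
                   (trans (h-pow _ (2 ℕ.* (m ∸ i)))
                          (reflexive (≡.trans (pow≡^ (U′ (k ℤ.* (+ i ℤ.+ + 1))) (2 ℕ.* (m ∸ i)))
                                              (≡.cong (λ e → U′ (k ℤ.* e) ^ (2 ℕ.* (m ∸ i))) (≡.cong +_ (ℕ.+-comm i 1)))))))

    ι-rhs : ι rhs ≈ (- 1#) ^ C₂ * ((α * β) ^ C₂ * ((t̄^ k * t^ k) ^ (2 ℕ.* C₃) * Π))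
    ι-rhs = begin
      ι rhs
        ≈⟨ trans (ι-* _ _) (*-cong (h-signℤ e₁) (trans (ι-* _ _) (*-cong (h-pow (ΔP R p q r a b c x) C₂)
                                                                         (trans (ι-* _ _) (*-cong (h-zpow c c⁻¹ e₂) ι-product))))) ⟩
      signℤ ring′ e₁ * (pow ring′ Δ C₂ * (c^ e₂ * Π))
        ≈⟨ *-cong sign-exponent (*-cong (reflexive (pow≡^ Δ C₂)) (*-congʳ c-exponent)) ⟩
      (±1^ t₀ ^ C₂ * (- 1#) ^ C₂) * (Δ ^ C₂ * ((c^ t₀ ^ C₂ * c^ k ^ (2 ℕ.* C₃)) * Π))
        ≈⟨ solve 6 (λ st s d ct ck π → (st :* s) :* (d :* ((ct :* ck) :* π)) := s :* ((d :* (st :* ct)) :* ((con (+ 1) :* ck) :* π))) refl _ _ _ _ _ _ ⟩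
      (- 1#) ^ C₂ * ((Δ ^ C₂ * (±1^ t₀ ^ C₂ * c^ t₀ ^ C₂)) * ((1# * c^ k ^ (2 ℕ.* C₃)) * Π))
        ≈⟨ *-congˡ (*-cong (sym αβ^C₂) (*-congʳ (sym roots^2C₃))) ⟩
      (- 1#) ^ C₂ * ((α * β) ^ C₂ * ((t̄^ k * t^ k) ^ (2 ℕ.* C₃) * Π)) ∎
      where
      Δ : Carrier′
      Δ = ι (ΔP R p q r a b c x)
      αβ^C₂ : (α * β) ^ C₂ ≈ Δ ^ C₂ * (±1^ t₀ ^ C₂ * c^ t₀ ^ C₂)
      αβ^C₂ = trans (^-congˡ C₂ α*β) (trans (^-distrib-* _ _ C₂) (*-congˡ (^-distrib-* _ _ C₂)))
      roots^2C₃ : (t̄^ k * t^ k) ^ (2 ℕ.* C₃) ≈ 1# * c^ k ^ (2 ℕ.* C₃)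
      roots^2C₃ = begin
        (t̄^ k * t^ k) ^ (2 ℕ.* C₃)                 ≈⟨ ^-congˡ (2 ℕ.* C₃) (trans (*-comm _ _) (t^*t̄^ k)) ⟩
        (±1^ k * c^ k) ^ (2 ℕ.* C₃)                ≈⟨ ^-distrib-* _ _ (2 ℕ.* C₃) ⟩
        ±1^ k ^ (2 ℕ.* C₃) * c^ k ^ (2 ℕ.* C₃)
          ≈⟨ *-congʳ (trans (sym (^-assocʳ (±1^ k) 2 C₃))
                            (trans (^-congˡ C₃ (trans (*-congˡ (*-identityʳ _)) (±1^-square k))) (MonomialMatrices.1#^n≈1# ring′ C₃))) ⟩
        1# * c^ k ^ (2 ℕ.* C₃)                     ∎

    ι-lhs≈ι-rhs : ι lhs ≈ ι rhs
    ι-lhs≈ι-rhs = begin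
      ι lhs                                                              ≈⟨ ι-lhs ⟩
      det ring′ (suc m) (λ i j → f (toℕ i ℕ.+ toℕ j) ^ m)               ≈⟨ det-hankel m ⟩
      (- 1#) ^ C₂ * ((α * β) ^ C₂ * ((t̄^ k * t^ k) ^ (2 ℕ.* C₃) * Π))  ≈⟨ ι-rhs ⟨
      ι rhs                                                              ∎

theorem2 : {ℓ₁ ℓ₂ : Level} (R : CommutativeRing ℓ₁ ℓ₂) →
    let open CommutativeRing R in
    (s k n : ℤ) (m : ℕ) → 1 ≤ m →
    (p q r a b c ci x : Carrier) → c * ci ≈ 1# → ci * c ≈ 1# →
    det R (ℕ.suc m)
        (λ i j → pow R (seqP R p q r a b c ci x
                          (s ℤ.+ k ℤ.* (n ℤ.+ + toℕ i ℤ.+ + toℕ j))) m)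
      ≈ signℤ R ((s ℤ.+ k ℤ.* n ℤ.+ + 1) ℤ.* + (ℕ.suc m C 2))
        * (pow R (ΔP R p q r a b c x) (ℕ.suc m C 2)
        * (zpow R c ci ((s ℤ.+ k ℤ.* n) ℤ.* + (ℕ.suc m C 2)
                          ℤ.+ + 2 ℤ.* k ℤ.* + (ℕ.suc m C 3))
        * prodF R (ℕ.suc m)
            (λ i → natR R (m C toℕ i)
                   * pow R (seqP R 0# 0# 1# a b c ci x
                              (k ℤ.* (+ toℕ i ℤ.+ + 1)))
                           (2 ℕ.* (m ℕ.∸ toℕ i)))))
theorem2 R s k n m _ p q r a b c c⁻¹ x c*c⁻¹≈1 _ =
  ι-injective ι-lhs≈ι-rhs
  where
  open HankelDeterminantOfP R p q r a b c c⁻¹ x c*c⁻¹≈1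
  open QuadraticExtension R σ c using (ι-injective)
  open Conclusion s k n m
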